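{- Suppose $n\geq 0$. \begin{enumerate} \item If $a$ is a binary sequence of length $n$, then $\mathcal{P}_a$ is a $2$-chain. \item If $P$ is an $(n+2)$-element $2$-chain, then $P\cong\mathcal{P}_a$ for some binary sequence $a$. \item If $a,b$ are binary sequences with $\mathcal{P}_a\cong\mathcal{P}_b$, then $b=a$ or $b=\bar a$. \end{enumerate}
   Context: All posets are finite; a partial order is written $\preceq$, with $p\prec q$ meaning $p\preceq q$ and $p\neq q$. A poset $(P,\preceq)$ is a $2$-chain if (1) there is a unique way to write $P$ as the (set) union of two chains, and (2) $\preceq$ is maximal subject to (1), i.e. for every proper refinement $\preceq^+$ of $\preceq$ there is more than one way to write $P$ as the union of two $\preceq^+$-chains. For a binary sequence $a=a_1\dots a_n$ (word in $\{0,1\}$), $\bar a$ is obtained by swapping $0$ and $1$ in every entry. Define sequences of length $n+1$: $a(0)=1a_1\dots a_n$, $a(i)=a_1\dots a_{i-1}\,0\,1\,a_{i+1}\dots a_n$ for $1\leq i\leq n$, and $a(n+1)=a_1\dots a_n0$. Two binary sequences $b,c$ of the same length are opposed if $b_i>c_i$ and $b_j<c_j$ for some $i,j$. $\mathcal{P}_a=\{a(0),\dots,a(n+1)\}$ with $a(i)\prec a(j)$ whenever $i<j$ and $a(i),a(j)$ are opposed; this is a partial order. -}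

module Defs where

open import Data.Bool using (Bool; true; false; not)
open import Data.Nat using (ℕ; zero; suc)
open import Data.Fin using (Fin; zero; suc; _<_)
open import Data.Fin.Subset using (Subset; _∈_; _∪_; ⊤)
open import Data.List using (List; []; _∷_; length; zip)
open import Data.List.Relation.Unary.Any using (Any)
open import Data.Product using (Σ; _×_; _,_)
open import Data.Sum using (_⊎_)
open import Relation.Nullary using (¬_)
open import Relation.Binary using (IsPartialOrder; Decidable)
open import Relation.Binary.PropositionalEquality using (_≡_)
open import Function.Bundles using (_⇔_)
open import Function.Definitions using (Bijective)
open import Level using (0ℓ) renaming (suc to lsuc)

-- Finite posets: carrier Fin m, relation R (R x y read "x ⪯ y").

FRel : ℕ → Set₁
FRel m = Fin m → Fin m → Set

IsFinPoset : ∀ {m} → FRel m → Set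
IsFinPoset R = IsPartialOrder _≡_ R × Decidable R

IsChain : ∀ {m} → FRel m → Subset m → Set
IsChain R C = ∀ x y → x ∈ C → y ∈ C → R x y ⊎ R y x

Decomp : ∀ {m} → FRel m → Subset m → Subset m → Set
Decomp R C D = IsChain R C × IsChain R D × (C ∪ D ≡ ⊤)

SamePair : ∀ {m} → Subset m → Subset m → Subset m → Subset m → Set
SamePair C D C' D' = (C ≡ C' × D ≡ D') ⊎ (C ≡ D' × D ≡ C')

UniqueDecomp : ∀ {m} → FRel m → Set
UniqueDecomp R =
  Σ (Subset _) λ C → Σ (Subset _) λ D →
    Decomp R C D × (∀ C' D' → Decomp R C' D' → SamePair C D C' D')

MoreThanOneDecomp : ∀ {m} → FRel m → Set
MoreThanOneDecomp R =
  Σ (Subset _) λ C → Σ (Subset _) λ D → Σ (Subset _) λ C' → Σ (Subset _) λ D' →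
    Decomp R C D × Decomp R C' D' × ¬ SamePair C D C' D'

ProperRefinement : ∀ {m} → FRel m → FRel m → Set
ProperRefinement R S =
  IsFinPoset S × (∀ x y → R x y → S x y) × (Σ _ λ x → Σ _ λ y → S x y × ¬ R x y)

IsTwoChain : ∀ {m} → FRel m → Set₁
IsTwoChain R =
  IsFinPoset R × UniqueDecomp R × (∀ S → ProperRefinement R S → MoreThanOneDecomp S)

Iso : ∀ {m k} → FRel m → FRel k → Set
Iso {m} {k} R S =
  Σ (Fin m → Fin k) λ f → Bijective _≡_ _≡_ f × (∀ x y → R x y ⇔ S (f x) (f y))

-- Binary sequences (false = 0, true = 1)

complement : List Bool → List Bool
complement = Data.List.map not

-- seqAt a i = a(i), for i = 0 .. n+1 (n = length a)
seqAt : (a : List Bool) → Fin (suc (suc (length a))) → List Bool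
seqAt a zero = true ∷ a
seqAt [] (suc zero) = false ∷ []
seqAt (x ∷ a) (suc zero) = false ∷ true ∷ a
seqAt (x ∷ a) (suc (suc j)) = x ∷ seqAt a (suc j)

Above : List Bool → List Bool → Set
Above b c = Any (λ p → Data.Product.proj₁ p ≡ true × Data.Product.proj₂ p ≡ false) (zip b c)

Opposed : List Bool → List Bool → Set
Opposed b c = Above b c × Above c b

-- the poset P_a, with element a(i) represented by the index i
PA : (a : List Bool) → FRel (suc (suc (length a)))
PA a i j = i ≡ j ⊎ (i < j × Opposed (seqAt a i) (seqAt a j))

{-# OPTIONS --safe #-}

-- Colour a(i) by the letter w_i of the word w = 0a1. For i < j, a(i) and a(j)
-- are incomparable exactly when (i , j) is a crossing: w_i w_j = 01 with no
-- 01 strictly between. So the colour classes are chains, and any other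
-- decomposition into two chains is forced onto them by following crossings
-- from a(0). The crossings form a tree, so a crossing made comparable can be
-- cut off by recolouring one side of it: P_a is maximal.
--
-- Conversely, extend the order of a 2-chain linearly, putting the element of
-- colour 0 first among two incomparable ones, and read off the colours along
-- this order: this gives a word a. A comparable 0-before-1 pair with no 01
-- between would allow a recolouring, and an incomparable pair with a 01
-- between would allow a proper refinement that still has a unique
-- decomposition; so the comparable pairs are exactly those of P_a.
--
-- An isomorphism P_a ≅ P_b preserves or swaps the unique colouring. If it
-- preserves it, it preserves the order of positions, so b = a; if it swaps it,
-- the same holds after replacing each position by its mirror (the next 0 or the
-- previous 1), and b = ā.

module Submission where

open import Defs
open import Data.Bool using (Bool; true; false; not; _xor_; if_then_else_)
open import Data.Bool.Properties
  using (¬-not; not-¬; not-injective; not-involutive; true-xor; xor-identityˡ) renaming (_≟_ to _≟𝔹_)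
open import Data.Nat using (ℕ; zero; suc; z≤n; s≤s; _<_; _≤_; _∸_; _+_; _<?_; _≤?_; _≟_)
open import Data.Nat.Properties
open import Data.Fin as Fin using (Fin; zero; suc; toℕ; fromℕ<; inject₁; punchOut; cast)
open import Data.Fin.Properties
  using ( toℕ-injective; toℕ<n; toℕ-fromℕ<; toℕ-fromℕ; fromℕ<-toℕ; toℕ-inject₁; toℕ-cast
        ; injective⇒≤; punchOut-injective) renaming (any? to anyFin?; 0≢1+n to Fin-0≢1+n)
open import Data.Fin.Induction using (<-wellFounded)
open import Data.Fin.Subset using (Subset; _∈_; _∉_; _∪_; ⊤; ∁; ∣_∣)
open import Data.Fin.Subset.Properties
  using (x∈∁p⇒x∉p; x∉p⇒x∈∁p; p∪∁p≡⊤; ∪-comm; x∈p∪q⁻; ∈⊤; ⊆-antisym; p⊂q⇒∣p∣<∣q∣; ∣⊤∣≡n)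
open import Data.Vec using (tabulate; lookup)
open import Data.Vec.Properties using ([]=⇒lookup; lookup⇒[]=; lookup∘tabulate; tabulate∘lookup; lookup-map)
open import Data.List using (List; []; _∷_; length; zip; applyUpTo)
open import Data.List.Properties using (length-map; length-applyUpTo)
open import Data.List.Relation.Unary.Any using (here; there; any?)
open import Data.Product using (Σ; ∃-syntax; _×_; _,_; proj₁; proj₂)
open import Data.Sum as Sum using (_⊎_; inj₁; inj₂; [_,_]′)
open import Data.Empty using (⊥; ⊥-elim)
open import Function using (_∘_; _∘′_)
open import Function.Bundles using (Equivalence; _⇔_; mk⇔)
open import Induction.WellFounded using (module All)
open import Relation.Nullary using (¬_; Dec; yes; no; does; contradiction)
open import Relation.Unary using (U; ∅)
open import Relation.Unary.Properties using (U?; ∅?)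
open import Relation.Nullary.Decidable using (_×-dec_; _⊎-dec_; ¬?; dec-true; dec-false)
open import Relation.Binary using (IsPartialOrder; Decidable; tri<; tri≈; tri>)
open import Relation.Binary.PropositionalEquality

false-or-true : ∀ b → b ≡ false ⊎ b ≡ true
false-or-true false = inj₁ refl
false-or-true true = inj₂ refl

colours-differ : ∀ {A : Set} {c : A → Bool} {k l} → c k ≡ false → c l ≡ true → k ≢ l
colours-differ ck cl refl with trans (sym ck) cl
... | ()

does-true : ∀ {A : Set} (a? : Dec A) → does a? ≡ true → A
does-true (yes a) _ = a

does-≢ : ∀ {P Q : Set} (P? : Dec P) (Q? : Dec Q) → does P? ≢ does Q? → (P × ¬ Q) ⊎ (¬ P × Q)
does-≢ (yes p) (no ¬q) _ = inj₁ (p , ¬q)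
does-≢ (no ¬p) (yes q) _ = inj₂ (¬p , q)
does-≢ (yes _) (yes _) differ = contradiction refl differ
does-≢ (no _) (no _) differ = contradiction refl differ

xor-cancelʳ : ∀ p q r s → p xor r ≡ q xor s → p ≡ q → r ≡ s
xor-cancelʳ false false r s e refl = e
xor-cancelʳ true true false false _ _ = refl
xor-cancelʳ true true true true _ _ = refl

IsLastBelow : (ℕ → Set) → ℕ → ℕ → Set
IsLastBelow P j m = m < j × P m × (∀ l → m < l → l < j → ¬ P l)

IsLeast : (ℕ → Set) → ℕ → Set
IsLeast P m = P m × (∀ l → l < m → ¬ P l)

module _ {P : ℕ → Set} (P? : ∀ k → Dec (P k)) where

  lastBelow? : ∀ j → (∃[ m ] IsLastBelow P j m) ⊎ (∀ l → l < j → ¬ P l)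
  lastBelow? zero = inj₂ λ _ ()
  lastBelow? (suc j) with P? j
  ... | yes p = inj₁ (j , ≤-refl , p , λ l j<l l<1+j → ⊥-elim (<⇒≱ j<l (≤-pred l<1+j)))
  ... | no ¬p with lastBelow? j
  ...   | inj₁ (m , m<j , pm , gap) = inj₁ (m , m<n⇒m<1+n m<j , pm , gap′)
    where
    gap′ : ∀ l → m < l → l < suc j → ¬ P l
    gap′ l m<l l<1+j with m≤n⇒m<n∨m≡n (≤-pred l<1+j)
    ... | inj₁ l<j = gap l m<l l<j
    ... | inj₂ refl = ¬p
  ...   | inj₂ none = inj₂ λ l l<1+j → [ none l , (λ { refl → ¬p }) ]′ (m≤n⇒m<n∨m≡n (≤-pred l<1+j))

  lastBelow : ∀ {i j} → i < j → P i → ∃[ m ] IsLastBelow P j m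
  lastBelow {i} {j} i<j pi with lastBelow? j
  ... | inj₁ found = found
  ... | inj₂ none = contradiction pi (none i i<j)

  least≤? : ∀ k → (∃[ m ] m ≤ k × IsLeast P m) ⊎ (∀ l → l ≤ k → ¬ P l)
  least≤? zero with P? zero
  ... | yes p = inj₁ (zero , z≤n , p , λ _ ())
  ... | no ¬p = inj₂ λ { zero _ → ¬p }
  least≤? (suc k) with least≤? k
  ... | inj₁ (m , m≤k , least) = inj₁ (m , m≤n⇒m≤1+n m≤k , least)
  ... | inj₂ none with P? (suc k)
  ...   | yes p = inj₁ (suc k , ≤-refl , p , λ l l<1+k → none l (≤-pred l<1+k))
  ...   | no ¬p = inj₂ λ l l≤1+k → [ (λ l<1+k → none l (≤-pred l<1+k)) , (λ { refl → ¬p }) ]′ (m≤n⇒m<n∨m≡n l≤1+k)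

  least : ∀ {k} → P k → ∃[ m ] m ≤ k × IsLeast P m
  least {k} pk with least≤? k
  ... | inj₁ found = found
  ... | inj₂ none = contradiction pk (none k ≤-refl)

injective⇒surjective : ∀ {m} (f : Fin m → Fin m) → (∀ {x y} → f x ≡ f y → x ≡ y) →
                       ∀ y → ∃[ x ] f x ≡ y
injective⇒surjective {zero} f inj ()
injective⇒surjective {suc m} f inj y with anyFin? (λ x → f x Fin.≟ y)
... | yes found = found
... | no missed = contradiction (injective⇒≤ skipY-injective) (<-irrefl refl)
  where
  skipY : Fin (suc m) → Fin m
  skipY x = punchOut {i = y} {j = f x} λ e → missed (x , sym e)
  skipY-injective : ∀ {x x′} → skipY x ≡ skipY x′ → x ≡ x′
  skipY-injective {x} {x′} e =
    inj (punchOut-injective (λ e′ → missed (x , sym e′)) (λ e′ → missed (x′ , sym e′)) e)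

strictlyIncreasing⇒toℕ-id :
  ∀ {m n} → m ≡ n → (f : Fin m → Fin n) → (∀ {x y} → toℕ x < toℕ y → toℕ (f x) < toℕ (f y)) →
  ∀ x → toℕ (f x) ≡ toℕ x
strictlyIncreasing⇒toℕ-id {m} refl f increasing x =
  ≤-antisym (below-top (m ∸ suc (toℕ x)) x (m+[n∸m]≡n (toℕ<n x))) (above-start (toℕ x) x refl)
  where
  above-start : ∀ k x → toℕ x ≡ k → k ≤ toℕ (f x)
  above-start zero x _ = z≤n
  above-start (suc k) (suc y) e =
    ≤-<-trans (above-start k (inject₁ y) (trans (toℕ-inject₁ y) (suc-injective e)))
              (increasing (s≤s (≤-reflexive (toℕ-inject₁ y))))
  below-top : ∀ k x → suc (toℕ x) + k ≡ m → toℕ (f x) ≤ toℕ x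
  below-top zero x e = ≤-pred (subst (toℕ (f x) <_) (trans (sym e) (cong suc (+-identityʳ _))) (toℕ<n (f x)))
  below-top (suc k) x e =
    ≤-pred (subst (toℕ (f x) <_) (toℕ-fromℕ< next<m) (<-≤-trans (increasing x<next) (below-top k next e′)))
    where
    next<m : suc (toℕ x) < m
    next<m = subst (suc (toℕ x) <_) e (s≤s (m<m+n (toℕ x) (s≤s z≤n)))
    next : Fin m
    next = fromℕ< next<m
    x<next : toℕ x < toℕ next
    x<next = subst (toℕ x <_) (sym (toℕ-fromℕ< next<m)) ≤-refl
    e′ : suc (toℕ next) + k ≡ m
    e′ = trans (cong (λ t → suc t + k) (toℕ-fromℕ< next<m)) (trans (sym (+-suc (suc (toℕ x)) k)) e)

-- Decompositions into two chains given by 2-colourings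

ones : ∀ {m} → (Fin m → Bool) → Subset m
ones = tabulate

zeros : ∀ {m} → (Fin m → Bool) → Subset m
zeros col = ∁ (ones col)

module _ {m : ℕ} {col : Fin m → Bool} {x : Fin m} where

  ∈-ones⁻ : x ∈ ones col → col x ≡ true
  ∈-ones⁻ x∈ = trans (sym (lookup∘tabulate col x)) ([]=⇒lookup x∈)

  ∈-ones⁺ : col x ≡ true → x ∈ ones col
  ∈-ones⁺ e = lookup⇒[]= x _ (trans (lookup∘tabulate col x) e)

  ∈-zeros⁻ : x ∈ zeros col → col x ≡ false
  ∈-zeros⁻ x∈ with false-or-true (col x)
  ... | inj₁ e = e
  ... | inj₂ e = contradiction (∈-ones⁺ e) (x∈∁p⇒x∉p x∈)

  ∈-zeros⁺ : col x ≡ false → x ∈ zeros col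
  ∈-zeros⁺ e = x∉p⇒x∈∁p λ x∈ → contradiction (trans (sym (∈-ones⁻ x∈)) e) λ ()

ChainColouring : ∀ {m} → FRel m → (Fin m → Bool) → Set
ChainColouring R col = ∀ x y → col x ≡ col y → R x y ⊎ R y x

UniqueColouring : ∀ {m} → FRel m → (Fin m → Bool) → Set
UniqueColouring R col =
  ChainColouring R col × (∀ C D → Decomp R C D → SamePair (zeros col) (ones col) C D)

module _ {m : ℕ} {R : FRel m} {col : Fin m → Bool} where

  colouringDecomp : ChainColouring R col → Decomp R (zeros col) (ones col)
  colouringDecomp chain =
      (λ x y x∈ y∈ → chain x y (trans (∈-zeros⁻ x∈) (sym (∈-zeros⁻ y∈))))
    , (λ x y x∈ y∈ → chain x y (trans (∈-ones⁻ x∈) (sym (∈-ones⁻ y∈))))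
    , trans (∪-comm (zeros col) (ones col)) (p∪∁p≡⊤ (ones col))

  decomp⇒chainColouring : Decomp R (zeros col) (ones col) → ChainColouring R col
  decomp⇒chainColouring (chain₀ , chain₁ , _) x y e with false-or-true (col x)
  ... | inj₁ cx = chain₀ x y (∈-zeros⁺ cx) (∈-zeros⁺ (trans (sym e) cx))
  ... | inj₂ cx = chain₁ x y (∈-ones⁺ cx) (∈-ones⁺ (trans (sym e) cx))

  uniqueColouring⇒uniqueDecomp : UniqueColouring R col → UniqueDecomp R
  uniqueColouring⇒uniqueDecomp (chain , unique) = zeros col , ones col , colouringDecomp chain , unique

uniqueDecomp⇒uniqueColouring : ∀ {m} {R : FRel (suc m)} → UniqueDecomp R → ∃[ col ] UniqueColouring R col
uniqueDecomp⇒uniqueColouring {R = R} (C , D , (chainC , chainD , cover) , unique) =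
  lookup D , decomp⇒chainColouring decomp , unique′
  where
  ones≡D : ones (lookup D) ≡ D
  ones≡D = tabulate∘lookup D

  ∁D⊆C : ∀ {x} → x ∈ ∁ D → x ∈ C
  ∁D⊆C {x} x∈ = [ (λ x∈C → x∈C) , (λ x∈D → contradiction x∈D (x∈∁p⇒x∉p x∈)) ]′
                  (x∈p∪q⁻ C D (subst (x ∈_) (sym cover) ∈⊤))

  -- (∁ D , D) is a decomposition too; it is not the swapped pair since D ≢ ∁ D.
  C≡∁D : C ≡ ∁ D
  C≡∁D with unique (∁ D) D ( (λ x y x∈ y∈ → chainC x y (∁D⊆C x∈) (∁D⊆C y∈))
                           , chainD , trans (∪-comm (∁ D) D) (p∪∁p≡⊤ D))
  ... | inj₁ (C≡∁D , _) = C≡∁D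
  ... | inj₂ (_ , D≡∁D) = contradiction (trans (cong (λ v → lookup v zero) D≡∁D) (lookup-map zero not D))
                                        (not-¬ refl)

  zeros≡C : zeros (lookup D) ≡ C
  zeros≡C = trans (cong ∁ ones≡D) (sym C≡∁D)

  decomp : Decomp R (zeros (lookup D)) (ones (lookup D))
  decomp = subst₂ (Decomp R) (sym zeros≡C) (sym ones≡D) (chainC , chainD , cover)

  unique′ : ∀ C′ D′ → Decomp R C′ D′ → SamePair (zeros (lookup D)) (ones (lookup D)) C′ D′
  unique′ C′ D′ d = subst₂ (λ X Y → SamePair X Y C′ D′) (sym zeros≡C) (sym ones≡D) (unique C′ D′ d)

samePair⇒same-or-opposite : ∀ {m} {c d : Fin m → Bool} → SamePair (zeros c) (ones c) (zeros d) (ones d) →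
                            (∀ x → d x ≡ c x) ⊎ (∀ x → d x ≡ not (c x))
samePair⇒same-or-opposite {c = c} {d} (inj₁ (_ , ones-c≡ones-d)) = inj₁ λ x →
  trans (sym (lookup∘tabulate d x)) (trans (cong (λ v → lookup v x) (sym ones-c≡ones-d)) (lookup∘tabulate c x))
samePair⇒same-or-opposite {c = c} {d} (inj₂ (_ , ones-c≡zeros-d)) = inj₂ λ x → begin
  d x                                ≡⟨ sym (lookup∘tabulate d x) ⟩
  lookup (ones d) x                  ≡⟨ sym (not-involutive _) ⟩
  not (not (lookup (ones d) x))      ≡⟨ cong not (sym (lookup-map x not (ones d))) ⟩
  not (lookup (zeros d) x)           ≡⟨ cong (λ v → not (lookup v x)) (sym ones-c≡zeros-d) ⟩
  not (lookup (ones c) x)            ≡⟨ cong not (lookup∘tabulate c x) ⟩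
  not (c x)                          ∎
  where open ≡-Reasoning

samePair-trans : ∀ {m} {C D C₁ D₁ C₂ D₂ : Subset m} → SamePair C D C₁ D₁ → SamePair C D C₂ D₂ → SamePair C₁ D₁ C₂ D₂
samePair-trans (inj₁ (refl , refl)) (inj₁ (refl , refl)) = inj₁ (refl , refl)
samePair-trans (inj₁ (refl , refl)) (inj₂ (refl , refl)) = inj₂ (refl , refl)
samePair-trans (inj₂ (refl , refl)) (inj₁ (refl , refl)) = inj₂ (refl , refl)
samePair-trans (inj₂ (refl , refl)) (inj₂ (refl , refl)) = inj₁ (refl , refl)

flipColouring : ∀ {m} {S : FRel m} {col : Fin m → Bool} (A : Fin m → Bool) → ChainColouring S col →
                (∀ x y → col x ≢ col y → A x ≢ A y → S x y ⊎ S y x) →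
                ChainColouring S (λ x → A x xor col x)
flipColouring {col = col} A chain separated x y e with col x ≟𝔹 col y
... | yes same = chain x y same
... | no differ = separated x y differ λ same-side → differ (xor-cancelʳ _ _ _ _ e same-side)

flip-notSamePair : ∀ {m} {col : Fin m → Bool} (A : Fin m → Bool) {z z′} → A z ≡ true → A z′ ≡ false →
                   ¬ SamePair (zeros col) (ones col) (zeros (λ x → A x xor col x)) (ones (λ x → A x xor col x))
flip-notSamePair {col = col} A {z} {z′} Az Az′ sp with samePair⇒same-or-opposite sp
... | inj₁ same = not-¬ refl (trans (sym (same z)) (trans (cong (_xor col z) Az) (true-xor (col z))))
... | inj₂ opposite = not-¬ refl (trans (sym (trans (cong (_xor col z′) Az′) (xor-identityˡ (col z′)))) (opposite z′))

module Ranking {m : ℕ} {_≺_ : Fin m → Fin m → Set} (_≺?_ : ∀ u v → Dec (u ≺ v))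
               (≺-irrefl : ∀ {u} → ¬ u ≺ u) (≺-trans : ∀ {u v w} → u ≺ v → v ≺ w → u ≺ w)
               (≺-total : ∀ u v → u ≢ v → u ≺ v ⊎ v ≺ u) where

  predecessors : Fin m → Subset m
  predecessors u = ones λ w → does (w ≺? u)

  ∈-predecessors⁺ : ∀ {w u} → w ≺ u → w ∈ predecessors u
  ∈-predecessors⁺ {w} {u} w≺u = ∈-ones⁺ (dec-true (w ≺? u) w≺u)

  ∈-predecessors⁻ : ∀ {w u} → w ∈ predecessors u → w ≺ u
  ∈-predecessors⁻ {w} {u} w∈ = does-true (w ≺? u) (∈-ones⁻ w∈)

  predecessors⊂ : ∀ {u v} → u ≺ v → ∣ predecessors u ∣ < ∣ predecessors v ∣
  predecessors⊂ {u} u≺v = p⊂q⇒∣p∣<∣q∣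
    ( (λ w∈ → ∈-predecessors⁺ (≺-trans (∈-predecessors⁻ w∈) u≺v))
    , u , ∈-predecessors⁺ u≺v , λ u∈ → ≺-irrefl (∈-predecessors⁻ u∈))

  ∣predecessors∣<m : ∀ u → ∣ predecessors u ∣ < m
  ∣predecessors∣<m u = subst (∣ predecessors u ∣ <_) (∣⊤∣≡n m)
    (p⊂q⇒∣p∣<∣q∣ ((λ _ → ∈⊤) , u , ∈⊤ , λ u∈ → ≺-irrefl (∈-predecessors⁻ u∈)))

  opaque
    rank : Fin m → Fin m
    rank u = fromℕ< (∣predecessors∣<m u)

    toℕ-rank : ∀ u → toℕ (rank u) ≡ ∣ predecessors u ∣
    toℕ-rank u = toℕ-fromℕ< (∣predecessors∣<m u)

  rank-mono : ∀ {u v} → u ≺ v → toℕ (rank u) < toℕ (rank v)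
  rank-mono {u} {v} u≺v = subst₂ _<_ (sym (toℕ-rank u)) (sym (toℕ-rank v)) (predecessors⊂ u≺v)

  rank-injective : ∀ {u v} → rank u ≡ rank v → u ≡ v
  rank-injective {u} {v} e with u Fin.≟ v
  ... | yes u≡v = u≡v
  ... | no u≢v with ≺-total u v u≢v
  ...   | inj₁ u≺v = contradiction (cong toℕ e) (<⇒≢ (rank-mono u≺v))
  ...   | inj₂ v≺u = contradiction (cong toℕ (sym e)) (<⇒≢ (rank-mono v≺u))

  rank-reflects : ∀ {u v} → toℕ (rank u) < toℕ (rank v) → u ≺ v
  rank-reflects {u} {v} lt with u Fin.≟ v
  ... | yes refl = contradiction lt (<-irrefl refl)
  ... | no u≢v with ≺-total u v u≢v
  ...   | inj₁ u≺v = u≺v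
  ...   | inj₂ v≺u = contradiction (rank-mono v≺u) (<-asym lt)

  opaque
    element : Fin m → Fin m
    element t = proj₁ (injective⇒surjective rank rank-injective t)

    rank-element : ∀ t → rank (element t) ≡ t
    rank-element t = proj₂ (injective⇒surjective rank rank-injective t)

  element-rank : ∀ u → element (rank u) ≡ u
  element-rank u = rank-injective (rank-element (rank u))

  toℕ-rank-element : ∀ {t} (t<m : t < m) → toℕ (rank (element (fromℕ< t<m))) ≡ t
  toℕ-rank-element t<m = trans (cong toℕ (rank-element (fromℕ< t<m))) (toℕ-fromℕ< t<m)

  module _ {P : Fin m → Set} (P? : ∀ u → Dec (P u)) where

    private
      AtPosition : ℕ → Set
      AtPosition t = Σ (t < m) λ t<m → P (element (fromℕ< t<m))

      atPosition? : ∀ t → Dec (AtPosition t)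
      atPosition? t with t <? m
      ... | no t≮m = no λ (t<m , _) → t≮m t<m
      ... | yes t<m with P? (element (fromℕ< t<m))
      ...   | yes p = yes (t<m , p)
      ...   | no ¬p = no λ (t<m′ , p) → ¬p p

      atRank : ∀ {u} → P u → AtPosition (toℕ (rank u))
      atRank {u} pu = toℕ<n (rank u) , subst P (sym (trans (cong element (fromℕ<-toℕ (rank u) _)) (element-rank u))) pu

    opaque
      maximalIn : ∀ {w} → P w → ∃[ y ] P y × (∀ u → P u → ¬ y ≺ u)
      maximalIn {w} pw with lastBelow atPosition? (toℕ<n (rank w)) (atRank pw)
      ... | t , _ , (t<m , py) , after = element (fromℕ< t<m) , py , λ u pu y≺u →
            after (toℕ (rank u)) (subst (_< toℕ (rank u)) (toℕ-rank-element t<m) (rank-mono y≺u))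
                  (toℕ<n (rank u)) (atRank pu)

      minimalIn : ∀ {w} → P w → ∃[ y ] P y × (∀ u → P u → ¬ u ≺ y)
      minimalIn {w} pw with least atPosition? (atRank pw)
      ... | t , _ , (t<m , py) , before = element (fromℕ< t<m) , py , λ u pu u≺y →
            before (toℕ (rank u)) (subst (toℕ (rank u) <_) (toℕ-rank-element t<m) (rank-mono u≺y)) (atRank pu)

-- Linear extensions from chain colourings

module ColourExtension {m : ℕ} {R : FRel m} (po : IsPartialOrder _≡_ R) (R? : Decidable R)
                       {col : Fin m → Bool} (chain : ChainColouring R col) where

  open IsPartialOrder po using () renaming (refl to R-refl; trans to R-trans; antisym to R-antisym)

  Incomparable : Fin m → Fin m → Set
  Incomparable u v = ¬ R u v × ¬ R v u

  infix 4 _≺_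
  _≺_ : Fin m → Fin m → Set
  u ≺ v = (R u v × u ≢ v) ⊎ (Incomparable u v × col u ≡ false)

  incomparable⇒opposite : ∀ {u v} → Incomparable u v → col u ≡ not (col v)
  incomparable⇒opposite {u} {v} (u≰v , v≰u) with false-or-true (col u) | false-or-true (col v)
  ... | inj₁ cu | inj₂ cv = trans cu (cong not (sym cv))
  ... | inj₂ cu | inj₁ cv = trans cu (cong not (sym cv))
  ... | inj₁ cu | inj₁ cv = ⊥-elim ([ u≰v , v≰u ]′ (chain u v (trans cu (sym cv))))
  ... | inj₂ cu | inj₂ cv = ⊥-elim ([ u≰v , v≰u ]′ (chain u v (trans cu (sym cv))))

  incomparable? : ∀ u v → R u v ⊎ R v u ⊎ Incomparable u v
  incomparable? u v with R? u v | R? v u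
  ... | yes r | _ = inj₁ r
  ... | no _ | yes r = inj₂ (inj₁ r)
  ... | no u≰v | no v≰u = inj₂ (inj₂ (u≰v , v≰u))

  _≺?_ : ∀ u v → Dec (u ≺ v)
  u ≺? v with R? u v | u Fin.≟ v
  ... | yes r | no u≢v = yes (inj₁ (r , u≢v))
  ... | yes r | yes u≡v = no λ { (inj₁ (_ , u≢v)) → u≢v u≡v ; (inj₂ ((u≰v , _) , _)) → u≰v r }
  ... | no u≰v | _ with R? v u | col u ≟𝔹 false
  ...   | yes r | _ = no λ { (inj₁ (r′ , _)) → u≰v r′ ; (inj₂ ((_ , v≰u) , _)) → v≰u r }
  ...   | no v≰u | yes cu = yes (inj₂ ((u≰v , v≰u) , cu))
  ...   | no v≰u | no ¬cu = no λ { (inj₁ (r′ , _)) → u≰v r′ ; (inj₂ (_ , cu)) → ¬cu cu }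

  ≺-irrefl : ∀ {u} → ¬ u ≺ u
  ≺-irrefl (inj₁ (_ , u≢u)) = u≢u refl
  ≺-irrefl (inj₂ ((u≰u , _) , _)) = u≰u R-refl

  ≺-trans : ∀ {u v w} → u ≺ v → v ≺ w → u ≺ w
  ≺-trans (inj₁ (ruv , u≢v)) (inj₁ (rvw , _)) =
    inj₁ (R-trans ruv rvw , λ { refl → u≢v (R-antisym ruv rvw) })
  ≺-trans {u} {v} {w} (inj₁ (ruv , _)) (inj₂ ((v≰w , w≰v) , cv)) with incomparable? u w
  ... | inj₁ ruw = inj₁ (ruw , λ { refl → w≰v ruv })
  ... | inj₂ (inj₁ rwu) = ⊥-elim (w≰v (R-trans rwu ruv))
  ... | inj₂ (inj₂ uw) with false-or-true (col u)
  ...   | inj₁ cu = inj₂ (uw , cu)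
  ...   | inj₂ cu = ⊥-elim (not-¬ refl (begin
          col u       ≡⟨ incomparable⇒opposite uw ⟩
          not (col w) ≡⟨ sym (incomparable⇒opposite (v≰w , w≰v)) ⟩
          col v       ≡⟨ cv ⟩
          false       ≡⟨ cong not (sym cu) ⟩
          not (col u) ∎))
    where open ≡-Reasoning
  ≺-trans {u} {v} {w} (inj₂ ((u≰v , v≰u) , cu)) (inj₁ (rvw , _)) with incomparable? u w
  ... | inj₁ ruw = inj₁ (ruw , λ { refl → v≰u rvw })
  ... | inj₂ (inj₁ rwu) = ⊥-elim (v≰u (R-trans rvw rwu))
  ... | inj₂ (inj₂ uw) = inj₂ (uw , cu)
  ≺-trans {u} {v} (inj₂ ((u≰v , v≰u) , cu)) (inj₂ (_ , cv)) =
    ⊥-elim ([ u≰v , v≰u ]′ (chain u v (trans cu (sym cv))))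

  ≺-asym : ∀ {u v} → u ≺ v → ¬ v ≺ u
  ≺-asym u≺v v≺u = ≺-irrefl (≺-trans u≺v v≺u)

  ≺-total : ∀ u v → u ≢ v → u ≺ v ⊎ v ≺ u
  ≺-total u v u≢v with incomparable? u v
  ... | inj₁ r = inj₁ (inj₁ (r , u≢v))
  ... | inj₂ (inj₁ r) = inj₂ (inj₁ (r , λ e → u≢v (sym e)))
  ... | inj₂ (inj₂ (u≰v , v≰u)) with false-or-true (col u)
  ...   | inj₁ cu = inj₁ (inj₂ ((u≰v , v≰u) , cu))
  ...   | inj₂ cu = inj₂ (inj₂ ((v≰u , u≰v) , trans (incomparable⇒opposite (v≰u , u≰v)) (cong not cu)))

  ≺-sameColour⇒R : ∀ {u v} → col u ≡ col v → u ≺ v → R u v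
  ≺-sameColour⇒R _ (inj₁ (r , _)) = r
  ≺-sameColour⇒R e (inj₂ ((u≰v , v≰u) , _)) = ⊥-elim ([ u≰v , v≰u ]′ (chain _ _ e))

  ≺-fromOne⇒R : ∀ {u v} → col u ≡ true → u ≺ v → R u v
  ≺-fromOne⇒R _ (inj₁ (r , _)) = r
  ≺-fromOne⇒R cu (inj₂ (_ , cu′)) = contradiction (trans (sym cu) cu′) λ ()

-- The word 0a1 and its crossings

-- colour a k is the letter at position k (counting from 0) of the word 0a1;
-- it is the colour of the element a(k) of P_a.
colour : List Bool → ℕ → Bool
colour a zero = false
colour [] (suc k) = true
colour (x ∷ a) (suc zero) = x
colour (x ∷ a) (suc (suc k)) = colour a (suc k)

colour-last : ∀ a → colour a (suc (length a)) ≡ true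
colour-last [] = refl
colour-last (x ∷ a) = colour-last a

colour-complement : ∀ a t → 0 < t → t < suc (length a) → colour (complement a) t ≡ not (colour a t)
colour-complement (x ∷ a) (suc zero) _ _ = refl
colour-complement (x ∷ a) (suc (suc t)) _ (s≤s t<) = colour-complement a (suc t) (s≤s z≤n) t<
colour-complement [] (suc zero) _ (s≤s ())

colour-complement-last : ∀ a → colour (complement a) (suc (length a)) ≡ true
colour-complement-last [] = refl
colour-complement-last (x ∷ a) = colour-complement-last a

colour-injective : ∀ a b → length b ≡ length a →
                   (∀ t → t < suc (suc (length b)) → colour b t ≡ colour a t) → b ≡ a
colour-injective [] [] _ _ = refl
colour-injective (x ∷ a) (y ∷ b) |b|≡|a| same =
  cong₂ _∷_ (same 1 (s≤s (s≤s z≤n))) (colour-injective a b (suc-injective |b|≡|a|) same′)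
  where
  same′ : ∀ t → t < suc (suc (length b)) → colour b t ≡ colour a t
  same′ zero _ = refl
  same′ (suc t) (s≤s t<) = same (suc (suc t)) (s≤s (s≤s t<))

colour-applyUpTo : ∀ h k t → t < k → colour (applyUpTo h k) (suc t) ≡ h t
colour-applyUpTo h (suc k) zero _ = refl
colour-applyUpTo h (suc k) (suc t) (s≤s t<k) = colour-applyUpTo (λ j → h (suc j)) k t t<k

NoAscentBetween : (ℕ → Bool) → ℕ → ℕ → Set
NoAscentBetween c i j = ∀ k l → i < k → k < l → l < j → c k ≡ false → c l ≡ true → ⊥

-- For i < j the elements a(i), a(j) of P_a are incomparable exactly when
-- (i , j) is a crossing of the word 0a1.
Crossing : (ℕ → Bool) → ℕ → ℕ → Set
Crossing c i j = c i ≡ false × c j ≡ true × NoAscentBetween c i j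

LeadingZeros : (ℕ → Bool) → ℕ → Set
LeadingZeros c j = ∀ k → k < j → c (suc k) ≡ false

noAscent-mono : ∀ {c i j i′ j′} → i ≤ i′ → j′ ≤ j → NoAscentBetween c i j → NoAscentBetween c i′ j′
noAscent-mono i≤i′ j′≤j gap k l i′<k k<l l<j′ = gap k l (≤-<-trans i≤i′ i′<k) k<l (<-≤-trans l<j′ j′≤j)

module _ {c c′ : ℕ → Bool} {i j : ℕ} (shift : ∀ k → i < k → c′ (suc k) ≡ c k) where

  noAscent-unshift : NoAscentBetween c′ (suc i) (suc j) → NoAscentBetween c i j
  noAscent-unshift gap k l i<k k<l l<j ck cl =
    gap (suc k) (suc l) (s≤s i<k) (s≤s k<l) (s≤s l<j) (trans (shift k i<k) ck) (trans (shift l (<-trans i<k k<l)) cl)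

  noAscent-shift : NoAscentBetween c i j → NoAscentBetween c′ (suc i) (suc j)
  noAscent-shift gap (suc k) (suc l) (s≤s i<k) (s≤s k<l) (s≤s l<j) ck cl =
    gap k l i<k k<l l<j (trans (sym (shift k i<k)) ck) (trans (sym (shift l (<-trans i<k k<l))) cl)

noAscent-extend : ∀ {c i j} → c (suc i) ≡ true → NoAscentBetween c (suc i) j → NoAscentBetween c i j
noAscent-extend ci+1 gap k l i<k k<l l<j ck cl with m≤n⇒m<n∨m≡n i<k
... | inj₁ i+1<k = gap k l i+1<k k<l l<j ck cl
... | inj₂ refl with trans (sym ci+1) ck
...   | ()

colour-∷ : ∀ x a i k → i < k → colour (x ∷ a) (suc k) ≡ colour a k
colour-∷ x a i (suc k) _ = refl

noAscent-0∷ : ∀ a j → NoAscentBetween (colour (false ∷ a)) 0 (suc (suc j)) → LeadingZeros (colour a) j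
noAscent-0∷ a j gap k k<j with false-or-true (colour a (suc k))
... | inj₁ isZero = isZero
... | inj₂ isOne = ⊥-elim (gap 1 (suc (suc k)) (s≤s z≤n) (s≤s (s≤s z≤n)) (s≤s (s≤s k<j)) refl isOne)

leadingZeros⇒noAscent-0∷ : ∀ a j → LeadingZeros (colour a) j → NoAscentBetween (colour (false ∷ a)) 0 (suc (suc j))
leadingZeros⇒noAscent-0∷ a j zeros (suc k) (suc (suc l)) _ _ (s≤s (s≤s l<j)) _ cl with trans (sym cl) (zeros l l<j)
... | ()

above? : ∀ b d → Dec (Above b d)
above? b d = any? (λ (x , y) → (x ≟𝔹 true) ×-dec (y ≟𝔹 false)) (zip b d)

Above-irrefl : ∀ b → ¬ Above b b
Above-irrefl (x ∷ b) (here (refl , ()))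
Above-irrefl (x ∷ b) (there above) = Above-irrefl b above

seqAt-above : ∀ a (i j : Fin (suc (suc (length a)))) → toℕ i < toℕ j → Above (seqAt a i) (seqAt a j)
seqAt-above [] zero (suc zero) _ = here (refl , refl)
seqAt-above (x ∷ a) zero (suc zero) _ = here (refl , refl)
seqAt-above (false ∷ a) zero (suc (suc j)) _ = here (refl , refl)
seqAt-above (true ∷ a) zero (suc (suc j)) _ = there (seqAt-above a zero (suc j) (s≤s z≤n))
seqAt-above (x ∷ a) (suc zero) (suc (suc j)) _ = there (seqAt-above a zero (suc j) (s≤s z≤n))
seqAt-above (x ∷ a) (suc (suc i)) (suc (suc j)) (s≤s i<j) = there (seqAt-above a (suc i) (suc j) i<j)
seqAt-above [] (suc zero) (suc zero) (s≤s ())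
seqAt-above (x ∷ a) (suc zero) (suc zero) (s≤s ())
seqAt-above (x ∷ a) (suc (suc i)) (suc zero) (s≤s ())

-- The tail of (0a)(0) = 10a is 0a, and the tail of (0a)(j+2) is a(j+1).
¬above-0a⇒leadingZeros : ∀ a (j : Fin (suc (length a))) → ¬ Above (seqAt a (suc j)) (false ∷ a) →
                         colour a (suc (toℕ j)) ≡ true × LeadingZeros (colour a) (toℕ j)
¬above-0a⇒leadingZeros [] zero _ = refl , λ _ ()
¬above-0a⇒leadingZeros (false ∷ a) zero ¬above = ⊥-elim (¬above (there (here (refl , refl))))
¬above-0a⇒leadingZeros (true ∷ a) zero _ = refl , λ _ ()
¬above-0a⇒leadingZeros (true ∷ a) (suc j) ¬above = ⊥-elim (¬above (here (refl , refl)))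
¬above-0a⇒leadingZeros (false ∷ a) (suc j) ¬above with ¬above-0a⇒leadingZeros a j (λ above → ¬above (there above))
... | cj , zeros = cj , λ { zero _ → refl ; (suc k) (s≤s k<j) → zeros k k<j }

leadingZeros⇒¬above-0a : ∀ a (j : Fin (suc (length a))) → colour a (suc (toℕ j)) ≡ true →
                         LeadingZeros (colour a) (toℕ j) → ¬ Above (seqAt a (suc j)) (false ∷ a)
leadingZeros⇒¬above-0a [] zero _ _ above = Above-irrefl (false ∷ []) above
leadingZeros⇒¬above-0a (y ∷ a) zero _ _ (here (() , _))
leadingZeros⇒¬above-0a (y ∷ a) zero cj _ (there (here (refl , y≡false))) with trans (sym cj) y≡false
... | ()
leadingZeros⇒¬above-0a (y ∷ a) zero _ _ (there (there above)) = Above-irrefl a above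
leadingZeros⇒¬above-0a (y ∷ a) (suc j) cj zeros above with zeros zero (s≤s z≤n) | above
... | refl | here (() , _)
... | refl | there above′ = leadingZeros⇒¬above-0a a j cj (λ k k<j → zeros (suc k) (s≤s k<j)) above′

crossing⇒¬above : ∀ a (i j : Fin (suc (suc (length a)))) → toℕ i < toℕ j →
                  Crossing (colour a) (toℕ i) (toℕ j) → ¬ Above (seqAt a j) (seqAt a i)
crossing⇒¬above [] zero (suc zero) _ _ (here (() , _))
crossing⇒¬above (x ∷ a) zero (suc zero) _ _ (here (() , _))
crossing⇒¬above (x ∷ a) zero (suc zero) _ (_ , x≡true , _) (there (here (refl , x≡false)))
  with trans (sym x≡true) x≡false
... | ()
crossing⇒¬above (x ∷ a) zero (suc zero) _ _ (there (there above)) = Above-irrefl a above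
crossing⇒¬above (x ∷ a) zero (suc (suc j)) _ _ (here (_ , ()))
crossing⇒¬above (true ∷ a) zero (suc (suc j)) _ (_ , cj , gap) (there above) =
  crossing⇒¬above a zero (suc j) (s≤s z≤n)
    (refl , cj , noAscent-unshift (colour-∷ true a 0) (noAscent-mono (n≤1+n 0) ≤-refl gap)) above
crossing⇒¬above (false ∷ a) zero (suc (suc j)) _ (_ , cj , gap) (there above) =
  leadingZeros⇒¬above-0a a j cj (noAscent-0∷ a (toℕ j) gap) above
crossing⇒¬above (x ∷ a) (suc zero) (suc (suc j)) _ (x≡false , _) (here (x≡true , _)) with trans (sym x≡true) x≡false
... | ()
crossing⇒¬above (x ∷ a) (suc zero) (suc (suc j)) _ (_ , cj , gap) (there above) =
  crossing⇒¬above a zero (suc j) (s≤s z≤n) (refl , cj , noAscent-unshift (colour-∷ x a 0) gap) above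
crossing⇒¬above (x ∷ a) (suc (suc i)) (suc (suc j)) _ _ (here (refl , ()))
crossing⇒¬above (x ∷ a) (suc (suc i)) (suc (suc j)) (s≤s i<j) (ci , cj , gap) (there above) =
  crossing⇒¬above a (suc i) (suc j) i<j (ci , cj , noAscent-unshift (colour-∷ x a (suc (toℕ i))) gap) above
crossing⇒¬above [] (suc zero) (suc zero) (s≤s ())
crossing⇒¬above (x ∷ a) (suc zero) (suc zero) (s≤s ())
crossing⇒¬above (x ∷ a) (suc (suc i)) (suc zero) (s≤s ())

¬above⇒crossing : ∀ a (i j : Fin (suc (suc (length a)))) → toℕ i < toℕ j →
                  ¬ Above (seqAt a j) (seqAt a i) → Crossing (colour a) (toℕ i) (toℕ j)
¬above⇒crossing [] zero (suc zero) _ _ = refl , refl , λ { (suc k) (suc l) _ (s≤s k<l) (s≤s ()) }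
¬above⇒crossing (false ∷ a) zero (suc zero) _ ¬above = ⊥-elim (¬above (there (here (refl , refl))))
¬above⇒crossing (true ∷ a) zero (suc zero) _ _ = refl , refl , λ { (suc k) (suc l) _ (s≤s k<l) (s≤s ()) }
¬above⇒crossing (true ∷ a) zero (suc (suc j)) _ ¬above
  with ¬above⇒crossing a zero (suc j) (s≤s z≤n) (λ above → ¬above (there above))
... | _ , cj , gap = refl , cj , noAscent-extend refl (noAscent-shift (colour-∷ true a 0) gap)
¬above⇒crossing (false ∷ a) zero (suc (suc j)) _ ¬above
  with ¬above-0a⇒leadingZeros a j (λ above → ¬above (there above))
... | cj , zeros = refl , cj , leadingZeros⇒noAscent-0∷ a (toℕ j) zeros
¬above⇒crossing (true ∷ a) (suc zero) (suc (suc j)) _ ¬above = ⊥-elim (¬above (here (refl , refl)))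
¬above⇒crossing (false ∷ a) (suc zero) (suc (suc j)) _ ¬above
  with ¬above⇒crossing a zero (suc j) (s≤s z≤n) (λ above → ¬above (there above))
... | _ , cj , gap = refl , cj , noAscent-shift (colour-∷ false a 0) gap
¬above⇒crossing (x ∷ a) (suc (suc i)) (suc (suc j)) (s≤s i<j) ¬above
  with ¬above⇒crossing a (suc i) (suc j) i<j (λ above → ¬above (there above))
... | ci , cj , gap = ci , cj , noAscent-shift (colour-∷ x a (suc (toℕ i))) gap
¬above⇒crossing [] (suc zero) (suc zero) (s≤s ())
¬above⇒crossing (x ∷ a) (suc zero) (suc zero) (s≤s ())
¬above⇒crossing (x ∷ a) (suc (suc i)) (suc zero) (s≤s ())

noOnes⇒noAscent : ∀ {c i j} → (∀ l → i < l → l < j → c l ≡ false) → NoAscentBetween c i j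
noOnes⇒noAscent zeros k l i<k k<l l<j _ cl with trans (sym cl) (zeros l (<-trans i<k k<l) l<j)
... | ()

noZeros⇒noAscent : ∀ {c i j} → (∀ k → i < k → k < j → c k ≡ true) → NoAscentBetween c i j
noZeros⇒noAscent ones k l i<k k<l l<j ck _ with trans (sym ck) (ones k i<k (<-trans k<l l<j))
... | ()

module _ {c : ℕ → Bool} where

  private
    one? : ∀ k → Dec (c k ≡ true)
    one? k = c k ≟𝔹 true

    zero? : ∀ k → Dec (c k ≡ false)
    zero? k = c k ≟𝔹 false

  lastZeroCrossing : ∀ {j} → c 0 ≡ false → c j ≡ true → ∃[ i ] i < j × Crossing c i j
  lastZeroCrossing {j} c0 cj with lastBelow zero? (n≢0⇒n>0 (≢-sym (colours-differ {c = c} c0 cj))) c0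
  ... | i , i<j , ci , after = i , i<j , ci , cj , noZeros⇒noAscent λ k i<k k<j → ¬-not (after k i<k k<j)

  firstOneAfter : ∀ {i t} → c t ≡ true → i < t →
                  ∃[ k ] i < k × k ≤ t × c k ≡ true × (∀ l → i < l → l < k → c l ≡ false)
  firstOneAfter {i} ct i<t with least (λ l → (i <? l) ×-dec one? l) (i<t , ct)
  ... | k , k≤t , (i<k , ck) , before = k , i<k , k≤t , ck , λ l i<l l<k → ¬-not λ cl → before l l<k (i<l , cl)

  -- If k is the first 1 after the 0 at x > 0, then some earlier 0 also
  -- crosses to k: the start of the word if no 1 precedes x, and otherwise the
  -- last 0 before the last 1 before x.
  earlierCrossing : ∀ {x k} → c 0 ≡ false → 0 < x → c x ≡ false → c k ≡ true → x < k →
                    (∀ l → x < l → l < k → c l ≡ false) → ∃[ i ] i < x × Crossing c i k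
  earlierCrossing {x} {k} c0 0<x cx ck x<k noOne with least one? ck
  ... | o₁ , _ , co₁ , before with <-cmp o₁ x
  ...   | tri≈ _ refl _ = contradiction refl (colours-differ {c = c} cx co₁)
  ...   | tri> _ _ x<o₁ = 0 , 0<x , c0 , ck , noOnes⇒noAscent noOneBelow
    where
    noOneBelow : ∀ l → 0 < l → l < k → c l ≡ false
    noOneBelow l _ l<k with <-cmp l x
    ... | tri< l<x _ _ = ¬-not (before l (<-trans l<x x<o₁))
    ... | tri≈ _ refl _ = cx
    ... | tri> _ _ x<l = noOne l x<l l<k
  ...   | tri< o₁<x _ _ with lastBelow one? o₁<x co₁
  ...     | o , o<x , co , afterO with lastBelow zero? (n≢0⇒n>0 (≢-sym (colours-differ {c = c} c0 co))) c0
  ...       | i , i<o , ci , afterI = i , <-trans i<o o<x , ci , ck , noAscent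
    where
    l≤o : ∀ l → l < k → c l ≡ true → l ≤ o
    l≤o l l<k cl with <-cmp o l
    ... | tri< o<l _ _ with <-cmp l x
    ...   | tri< l<x _ _ = contradiction cl (afterO l o<l l<x)
    ...   | tri≈ _ refl _ = contradiction refl (colours-differ {c = c} cx cl)
    ...   | tri> _ _ x<l = contradiction refl (colours-differ {c = c} (noOne l x<l l<k) cl)
    l≤o l l<k cl | tri≈ _ refl _ = ≤-refl
    l≤o l l<k cl | tri> _ _ l<o = <⇒≤ l<o
    noAscent : NoAscentBetween c i k
    noAscent k′ l i<k′ k′<l l<k ck′ cl = afterI k′ i<k′ (<-≤-trans k′<l (l≤o l l<k cl)) ck′

module _ {c : ℕ → Bool} {i k : ℕ} where

  otherPartners : ∀ {i′ k′} → Crossing c i k → i < k′ → Crossing c i k′ → i′ < k → Crossing c i′ k →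
                  k′ ≢ k → i′ ≢ i →
                  (k′ < k × i < i′) ⊎ (k < k′ × i′ < i)
  otherPartners {i′} {k′} (ci , ck , _) i<k′ (_ , ck′ , gapᵢₖ′) i′<k (ci′ , _ , gapᵢ′ₖ) k′≢k i′≢i
    with <-cmp k′ k | <-cmp i′ i
  ... | tri≈ _ k′≡k _ | _ = contradiction k′≡k k′≢k
  ... | _ | tri≈ _ i′≡i _ = contradiction i′≡i i′≢i
  ... | tri< k′<k _ _ | tri> _ _ i<i′ = inj₁ (k′<k , i<i′)
  ... | tri> _ _ k<k′ | tri< i′<i _ _ = inj₂ (k<k′ , i′<i)
  ... | tri< k′<k _ _ | tri< i′<i _ _ = ⊥-elim (gapᵢ′ₖ i k′ i′<i i<k′ k′<k ci ck′)
  ... | tri> _ _ k<k′ | tri> _ _ i<i′ = ⊥-elim (gapᵢₖ′ i′ k i<i′ i′<k k<k′ ci′ ck)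

  -- Cutting between the 0s up to i and the 1s before k only cuts (i , k).
  bridgeCut : ∀ {i′ k′} → Crossing c i k → i < k′ → Crossing c i k′ → k′ < k →
              i′ < k → Crossing c i′ k → i < i′ →
              ∀ {x y} → x < y → Crossing c x y → (x ≤ i → ¬ y < k → x ≡ i × y ≡ k) × (¬ x ≤ i → y < k → ⊥)
  bridgeCut {i′} {k′} (ci , ck , gapᵢₖ) i<k′ (_ , ck′ , _) k′<k i′<k (ci′ , _ , _) i<i′ {x} {y} x<y
            (cx , cy , gapₓᵧ) =
    sameEnds , λ x≰i y<k → gapᵢₖ x y (≰⇒> x≰i) x<y y<k cx cy
    where
    sameEnds : x ≤ i → ¬ y < k → x ≡ i × y ≡ k
    sameEnds x≤i y≮k with m≤n⇒m<n∨m≡n x≤i | m≤n⇒m<n∨m≡n (≮⇒≥ y≮k)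
    ... | inj₁ x<i | _ = ⊥-elim (gapₓᵧ i k′ x<i i<k′ (<-≤-trans k′<k (≮⇒≥ y≮k)) ci ck′)
    ... | inj₂ refl | inj₁ k<y = ⊥-elim (gapₓᵧ i′ k i<i′ i′<k k<y ci′ ck)
    ... | inj₂ refl | inj₂ refl = refl , refl

  -- Cutting between the 0s from i on and the 1s after k only cuts (i , k).
  centreCut : ∀ {i′ k′} → i < k → Crossing c i k → i < k′ → Crossing c i k′ → k < k′ →
              i′ < k → Crossing c i′ k → i′ < i →
              ∀ {x y} → x < y → Crossing c x y → (i ≤ x → ¬ k < y → x ≡ i × y ≡ k) × (¬ i ≤ x → k < y → ⊥)
  centreCut {i′} {k′} i<k (ci , ck , gapᵢₖ) i<k′ (_ , _ , gapᵢₖ′) k<k′ i′<k (_ , _ , gapᵢ′ₖ) i′<i {x} {y} x<y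
            (cx , cy , gapₓᵧ) =
    sameEnds , λ i≰x k<y → gapₓᵧ i k (≰⇒> i≰x) i<k k<y ci ck
    where
    sameEnds : i ≤ x → ¬ k < y → x ≡ i × y ≡ k
    sameEnds i≤x k≮y with m≤n⇒m<n∨m≡n i≤x | m≤n⇒m<n∨m≡n (≮⇒≥ k≮y)
    ... | inj₁ i<x | inj₁ y<k = ⊥-elim (gapᵢₖ x y i<x x<y y<k cx cy)
    ... | inj₁ i<x | inj₂ refl = ⊥-elim (gapᵢₖ′ x k i<x x<y k<k′ cx ck)
    ... | inj₂ refl | inj₁ y<k = ⊥-elim (gapᵢ′ₖ i y i′<i x<y y<k ci cy)
    ... | inj₂ refl | inj₂ refl = refl , refl

module WordPoset (a : List Bool) where

  N : ℕ
  N = suc (suc (length a))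

  col : Fin N → Bool
  col x = colour a (toℕ x)

  Crossed : Fin N → Fin N → Set
  Crossed x y = toℕ x < toℕ y × Crossing (colour a) (toℕ x) (toℕ y)

  crossed? : ∀ x y → Dec (Crossed x y)
  crossed? x y with toℕ x <? toℕ y
  ... | no x≮y = no (x≮y ∘ proj₁)
  ... | yes x<y with above? (seqAt a y) (seqAt a x)
  ...   | yes above = no λ (_ , crossing) → crossing⇒¬above a x y x<y crossing above
  ...   | no ¬above = yes (x<y , ¬above⇒crossing a x y x<y ¬above)

  <∧¬crossing⇒PA : ∀ {x y} → toℕ x < toℕ y → ¬ Crossing (colour a) (toℕ x) (toℕ y) → PA a x y
  <∧¬crossing⇒PA {x} {y} x<y ¬crossing with above? (seqAt a y) (seqAt a x)
  ... | yes above = inj₂ (x<y , seqAt-above a x y x<y , above)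
  ... | no ¬above = ⊥-elim (¬crossing (¬above⇒crossing a x y x<y ¬above))

  PA∧≢⇒< : ∀ {x y} → PA a x y → x ≢ y → toℕ x < toℕ y
  PA∧≢⇒< (inj₁ x≡y) x≢y = contradiction x≡y x≢y
  PA∧≢⇒< (inj₂ (x<y , _)) _ = x<y

  PA⇒¬crossed : ∀ {x y} → PA a x y → ¬ Crossed x y
  PA⇒¬crossed (inj₁ refl) (x<x , _) = <-irrefl refl x<x
  PA⇒¬crossed {x} {y} (inj₂ (x<y , _ , above)) (_ , crossing) = crossing⇒¬above a x y x<y crossing above

  comparable⇒¬crossed : ∀ {x y} → PA a x y ⊎ PA a y x → ¬ Crossed x y
  comparable⇒¬crossed (inj₁ r) = PA⇒¬crossed r
  comparable⇒¬crossed (inj₂ (inj₁ refl)) (x<x , _) = <-irrefl refl x<x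
  comparable⇒¬crossed (inj₂ (inj₂ (y<x , _))) (x<y , _) = <-asym x<y y<x

  ¬crossed⇒comparable : ∀ x y → ¬ Crossed x y → ¬ Crossed y x → PA a x y ⊎ PA a y x
  ¬crossed⇒comparable x y ¬xy ¬yx with <-cmp (toℕ x) (toℕ y)
  ... | tri< x<y _ _ = inj₁ (<∧¬crossing⇒PA x<y λ crossing → ¬xy (x<y , crossing))
  ... | tri≈ _ x≡y _ = inj₁ (inj₁ (toℕ-injective x≡y))
  ... | tri> _ _ y<x = inj₂ (<∧¬crossing⇒PA y<x λ crossing → ¬yx (y<x , crossing))

  incomparable⇒crossed : ∀ {x y} → ¬ PA a x y → ¬ PA a y x → col x ≡ false → Crossed x y
  incomparable⇒crossed {x} {y} x≰y y≰x cx with crossed? x y | crossed? y x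
  ... | yes x×y | _ = x×y
  ... | no _ | yes (_ , _ , cx′ , _) with trans (sym cx) cx′
  ...   | ()
  incomparable⇒crossed {x} {y} x≰y y≰x cx | no ¬x×y | no ¬y×x =
    ⊥-elim ([ x≰y , y≰x ]′ (¬crossed⇒comparable x y ¬x×y ¬y×x))

  sameColour⇒comparable : ChainColouring (PA a) col
  sameColour⇒comparable x y same = ¬crossed⇒comparable x y (differ x y same) (differ y x (sym same))
    where
    differ : ∀ x y → col x ≡ col y → ¬ Crossed x y
    differ x y same (_ , cx , cy , _) with trans (sym cx) (trans same cy)
    ... | ()

  PA-trans : ∀ {x y z} → PA a x y → PA a y z → PA a x z
  PA-trans (inj₁ refl) ryz = ryz
  PA-trans (inj₂ rxy) (inj₁ refl) = inj₂ rxy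
  PA-trans {x} {y} {z} rxy@(inj₂ (x<y , _)) ryz@(inj₂ (y<z , _)) = <∧¬crossing⇒PA (<-trans x<y y<z) ¬crossing
    where
    ¬crossing : ¬ Crossing (colour a) (toℕ x) (toℕ z)
    ¬crossing (cx , cz , gap) with false-or-true (col y)
    ... | inj₁ cy = PA⇒¬crossed ryz (y<z , cy , cz , noAscent-mono (<⇒≤ x<y) ≤-refl gap)
    ... | inj₂ cy = PA⇒¬crossed rxy (x<y , cx , cy , noAscent-mono ≤-refl (<⇒≤ y<z) gap)

  PA-antisym : ∀ {x y} → PA a x y → PA a y x → x ≡ y
  PA-antisym (inj₁ x≡y) _ = x≡y
  PA-antisym (inj₂ _) (inj₁ y≡x) = sym y≡x
  PA-antisym (inj₂ (x<y , _)) (inj₂ (y<x , _)) = ⊥-elim (<-asym x<y y<x)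

  PA? : Decidable (PA a)
  PA? x y with x Fin.≟ y
  ... | yes x≡y = yes (inj₁ x≡y)
  ... | no x≢y with toℕ x <? toℕ y
  ...   | no x≮y = no λ { (inj₁ x≡y) → x≢y x≡y ; (inj₂ (x<y , _)) → x≮y x<y }
  ...   | yes x<y with crossed? x y
  ...     | yes crossed = no λ r → PA⇒¬crossed r crossed
  ...     | no ¬crossed = yes (<∧¬crossing⇒PA x<y λ crossing → ¬crossed (x<y , crossing))

  PA-isPartialOrder : IsPartialOrder _≡_ (PA a)
  PA-isPartialOrder = record
    { isPreorder = record
      { isEquivalence = isEquivalence
      ; reflexive = λ { refl → inj₁ refl }
      ; trans = PA-trans }
    ; antisym = PA-antisym }

  crossed-at : ∀ {x y i j} → toℕ x ≡ i → toℕ y ≡ j → i < j → Crossing (colour a) i j → Crossed x y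
  crossed-at refl refl = _,_

  zero⇒<last : ∀ {x} → col x ≡ false → toℕ x < suc (length a)
  zero⇒<last {x} cx with m≤n⇒m<n∨m≡n (≤-pred (toℕ<n x))
  ... | inj₁ x<top = x<top
  ... | inj₂ x≡top with trans (sym cx) (trans (cong (colour a) x≡top) (colour-last a))
  ...   | ()

  -- Uniqueness of the decomposition

  module Sorting {X Y : Subset N} (d : Decomp (PA a) X Y) where

    chainX : IsChain (PA a) X
    chainX = proj₁ d

    chainY : IsChain (PA a) Y
    chainY = proj₁ (proj₂ d)

    cover : X ∪ Y ≡ ⊤
    cover = proj₂ (proj₂ d)

    OnlyX OnlyY : Fin N → Set
    OnlyX x = x ∈ X × x ∉ Y
    OnlyY x = x ∈ Y × x ∉ X

    covered : ∀ x → x ∈ X ⊎ x ∈ Y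
    covered x = x∈p∪q⁻ X Y (subst (x ∈_) (sym cover) ∈⊤)

    crossed-fromX : ∀ {x y} → Crossed x y → x ∈ X → OnlyY y
    crossed-fromX {x} {y} crossed x∈X = [ (λ y∈X → ⊥-elim (y∉X y∈X)) , (λ y∈Y → y∈Y) ]′ (covered y) , y∉X
      where
      y∉X : y ∉ X
      y∉X y∈X = comparable⇒¬crossed (chainX x y x∈X y∈X) crossed

    crossed-toY : ∀ {x y} → Crossed x y → y ∈ Y → OnlyX x
    crossed-toY {x} {y} crossed y∈Y = [ (λ x∈X → x∈X) , (λ x∈Y → ⊥-elim (x∉Y x∈Y)) ]′ (covered x) , x∉Y
      where
      x∉Y : x ∉ Y
      x∉Y x∈Y = comparable⇒¬crossed (chainY x y x∈Y y∈Y) crossed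

    module _ (0∈X : zero ∈ X) where

      Sorted : Fin N → Set
      Sorted x = (col x ≡ false → OnlyX x) × (col x ≡ true → OnlyY x)

      SortedBelow : Fin N → Set
      SortedBelow x = ∀ {y} → toℕ y < toℕ x → Sorted y

      sortedOne : ∀ {x} → SortedBelow x → col x ≡ true → OnlyY x
      sortedOne {x} ih cx with lastZeroCrossing {c = colour a} refl cx
      ... | i , i<x , crossing@(ci , _) =
            crossed-fromX (crossed-at i′≡i refl i<x crossing)
                          (proj₁ (proj₁ (ih (subst (_< toℕ x) (sym i′≡i) i<x)) (trans (cong (colour a) i′≡i) ci)))
        where
        i′≡i : toℕ (fromℕ< (<-trans i<x (toℕ<n x))) ≡ i
        i′≡i = toℕ-fromℕ< _

      sortedZero : ∀ {x} → SortedBelow x → col x ≡ false → OnlyX x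
      sortedZero {x} ih cx with firstOneAfter {c = colour a} (colour-last a) (zero⇒<last {x} cx)
      ... | k , x<k , k≤last , ck , noOne with toℕ x in x≡
      ...   | zero = crossed-toY x×k (proj₁ (crossed-fromX x×k (subst (_∈ X) (sym (toℕ-injective x≡)) 0∈X)))
        where
        x×k : Crossed x (fromℕ< (s≤s k≤last))
        x×k = crossed-at x≡ (toℕ-fromℕ< (s≤s k≤last)) x<k (cx , ck , noOnes⇒noAscent noOne)
      ...   | suc _ with earlierCrossing {c = colour a} refl (s≤s z≤n) cx ck x<k noOne
      ...     | i , i<x , crossing@(ci , _) =
              crossed-toY x×k (proj₁ (crossed-fromX i×k (proj₁ (proj₁ (ih (subst (_< _) (sym i′≡i) i<x))
                                                                        (trans (cong (colour a) i′≡i) ci)))))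
        where
        x×k : Crossed x (fromℕ< (s≤s k≤last))
        x×k = crossed-at x≡ (toℕ-fromℕ< (s≤s k≤last)) x<k (cx , ck , noOnes⇒noAscent noOne)
        i′ : Fin N
        i′ = fromℕ< (<-trans i<x (subst (_< N) x≡ (toℕ<n x)))
        i′≡i : toℕ i′ ≡ i
        i′≡i = toℕ-fromℕ< _
        i×k : Crossed i′ (fromℕ< (s≤s k≤last))
        i×k = crossed-at i′≡i (toℕ-fromℕ< (s≤s k≤last)) (<-trans i<x x<k) crossing

      sorted : ∀ x → Sorted x
      sorted = All.wfRec <-wellFounded _ Sorted λ x ih → sortedZero ih , sortedOne ih

      canonical : X ≡ zeros col × Y ≡ ones col
      canonical = ⊆-antisym X⊆zeros zeros⊆X , ⊆-antisym Y⊆ones ones⊆Y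
        where
        X⊆zeros : ∀ {x} → x ∈ X → x ∈ zeros col
        X⊆zeros {x} x∈X with false-or-true (col x)
        ... | inj₁ cx = ∈-zeros⁺ {col = col} cx
        ... | inj₂ cx = ⊥-elim (proj₂ (proj₂ (sorted x) cx) x∈X)
        zeros⊆X : ∀ {x} → x ∈ zeros col → x ∈ X
        zeros⊆X {x} x∈ = proj₁ (proj₁ (sorted x) (∈-zeros⁻ {col = col} x∈))
        Y⊆ones : ∀ {x} → x ∈ Y → x ∈ ones col
        Y⊆ones {x} x∈Y with false-or-true (col x)
        ... | inj₁ cx = ⊥-elim (proj₂ (proj₁ (sorted x) cx) x∈Y)
        ... | inj₂ cx = ∈-ones⁺ {col = col} cx
        ones⊆Y : ∀ {x} → x ∈ ones col → x ∈ Y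
        ones⊆Y {x} x∈ = proj₁ (proj₂ (sorted x) (∈-ones⁻ {col = col} x∈))

  PA-uniqueColouring : UniqueColouring (PA a) col
  PA-uniqueColouring = sameColour⇒comparable , unique
    where
    unique : ∀ X Y → Decomp (PA a) X Y → SamePair (zeros col) (ones col) X Y
    unique X Y d@(chainX , chainY , cover) with Sorting.covered d zero
    ... | inj₁ 0∈X = let (X≡ , Y≡) = Sorting.canonical d 0∈X in inj₁ (sym X≡ , sym Y≡)
    ... | inj₂ 0∈Y = let (Y≡ , X≡) = Sorting.canonical (chainY , chainX , trans (∪-comm Y X) cover) 0∈Y
                     in inj₂ (sym Y≡ , sym X≡)

  -- Maximality: making a crossed pair (i , k) comparable allows a second
  -- decomposition, obtained by flipping the colours of a set A that
  -- separates i from k but no other crossed pair.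

  module Refinement (S : FRel N) (R⊆S : ∀ x y → PA a x y → S x y)
                    {i k : Fin N} (i×k : Crossed i k) (sik : S i k ⊎ S k i) where

    i<k : toℕ i < toℕ k
    i<k = proj₁ i×k

    ci : col i ≡ false
    ci = proj₁ (proj₂ i×k)

    ck : col k ≡ true
    ck = proj₁ (proj₂ (proj₂ i×k))

    CutsOnly : (Fin N → Bool) → Set
    CutsOnly A = ∀ x y → Crossed x y → A x ≢ A y → x ≡ i × y ≡ k

    flipped : (A : Fin N → Bool) → A i ≢ A k → CutsOnly A → MoreThanOneDecomp S
    flipped A Ai≢Ak cuts =
      zeros col , ones col , zeros col′ , ones col′ ,
      colouringDecomp chainS , colouringDecomp (flipColouring A chainS separated) , notSame (false-or-true (A i))
      where
      col′ : Fin N → Bool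
      col′ x = A x xor col x
      chainS : ChainColouring S col
      chainS x y same = Sum.map (R⊆S x y) (R⊆S y x) (sameColour⇒comparable x y same)
      separated : ∀ x y → col x ≢ col y → A x ≢ A y → S x y ⊎ S y x
      separated x y _ Ax≢Ay with crossed? x y | crossed? y x
      ... | yes x×y | _ with cuts x y x×y Ax≢Ay
      ...   | refl , refl = sik
      separated x y _ Ax≢Ay | no _ | yes y×x with cuts y x y×x (≢-sym Ax≢Ay)
      ...   | refl , refl = Sum.swap sik
      separated x y _ _ | no ¬x×y | no ¬y×x =
        Sum.map (R⊆S x y) (R⊆S y x) (¬crossed⇒comparable x y ¬x×y ¬y×x)
      notSame : A i ≡ false ⊎ A i ≡ true → ¬ SamePair (zeros col) (ones col) (zeros col′) (ones col′)
      notSame (inj₁ Ai) = flip-notSamePair {col = col} A (¬-not (λ Ak → Ai≢Ak (trans Ai (sym Ak)))) Ai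
      notSame (inj₂ Ai) = flip-notSamePair {col = col} A Ai (¬-not (λ Ak → Ai≢Ak (trans Ai (sym Ak))))

    flippedByColour : (P₀ P₁ : ℕ → Set) → (∀ t → Dec (P₀ t)) → (∀ t → Dec (P₁ t)) → P₀ (toℕ i) → ¬ P₁ (toℕ k) →
                      (∀ {x y} → Crossed x y → P₀ (toℕ x) → ¬ P₁ (toℕ y) → toℕ x ≡ toℕ i × toℕ y ≡ toℕ k) →
                      (∀ {x y} → Crossed x y → ¬ P₀ (toℕ x) → P₁ (toℕ y) → ⊥) →
                      MoreThanOneDecomp S
    flippedByColour P₀ P₁ P₀? P₁? p₀i ¬p₁k sameEnds noCut = flipped A Ai≢Ak cuts
      where
      A : Fin N → Bool
      A z = if col z then does (P₁? (toℕ z)) else does (P₀? (toℕ z))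
      A-zero : ∀ {z} → col z ≡ false → A z ≡ does (P₀? (toℕ z))
      A-zero {z} cz = cong (λ b → if b then does (P₁? (toℕ z)) else does (P₀? (toℕ z))) cz
      A-one : ∀ {z} → col z ≡ true → A z ≡ does (P₁? (toℕ z))
      A-one {z} cz = cong (λ b → if b then does (P₁? (toℕ z)) else does (P₀? (toℕ z))) cz
      Ai≢Ak : A i ≢ A k
      Ai≢Ak e = contradiction (trans (sym (dec-true (P₀? (toℕ i)) p₀i))
                                (trans (sym (A-zero ci)) (trans e (trans (A-one ck) (dec-false (P₁? (toℕ k)) ¬p₁k)))))
                              λ ()
      cuts : CutsOnly A
      cuts x y x×y@(_ , cx , cy , _) Ax≢Ay
        with does-≢ (P₀? (toℕ x)) (P₁? (toℕ y)) (λ e → Ax≢Ay (trans (A-zero cx) (trans e (sym (A-one cy)))))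
      ... | inj₁ (p₀x , ¬p₁y) = let (x≡i , y≡k) = sameEnds x×y p₀x ¬p₁y in toℕ-injective x≡i , toℕ-injective y≡k
      ... | inj₂ (¬p₀x , p₁y) = ⊥-elim (noCut x×y ¬p₀x p₁y)

    onlyPartnerOfi : (∀ y → y ≢ k → ¬ Crossed i y) → MoreThanOneDecomp S
    onlyPartnerOfi noOther = flippedByColour (_≡ toℕ i) ∅ (_≟ toℕ i) ∅? refl (λ ()) sameEnds λ _ _ ()
      where
      sameEnds : ∀ {x y} → Crossed x y → toℕ x ≡ toℕ i → ¬ ⊥ → toℕ x ≡ toℕ i × toℕ y ≡ toℕ k
      sameEnds {x} {y} x×y x≡i _ with y Fin.≟ k
      ... | yes y≡k = x≡i , cong toℕ y≡k
      ... | no y≢k = ⊥-elim (noOther y y≢k (subst (λ z → Crossed z y) (toℕ-injective x≡i) x×y))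

    onlyPartnerOfk : (∀ x → x ≢ i → ¬ Crossed x k) → MoreThanOneDecomp S
    onlyPartnerOfk noOther =
      flippedByColour U (_≢ toℕ k) U? (λ t → ¬? (t ≟ toℕ k)) _ (λ k≢k → k≢k refl) sameEnds λ _ ¬u _ → ¬u _
      where
      sameEnds : ∀ {x y} → Crossed x y → U (toℕ x) → ¬ toℕ y ≢ toℕ k → toℕ x ≡ toℕ i × toℕ y ≡ toℕ k
      sameEnds {x} {y} x×y _ ¬y≢k with toℕ y ≟ toℕ k | x Fin.≟ i
      ... | no y≢k | _ = ⊥-elim (¬y≢k y≢k)
      ... | yes y≡k | yes x≡i = cong toℕ x≡i , y≡k
      ... | yes y≡k | no x≢i = ⊥-elim (noOther x x≢i (subst (Crossed x) (toℕ-injective y≡k) x×y))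

    bridge : ∀ {i′ k′} → Crossed i k′ → Crossed i′ k → toℕ k′ < toℕ k → toℕ i < toℕ i′ → MoreThanOneDecomp S
    bridge (i<k′ , ik′) (i′<k , i′k) k′<k i<i′ =
      flippedByColour (_≤ toℕ i) (_< toℕ k) (_≤? toℕ i) (_<? toℕ k) ≤-refl (<-irrefl refl)
                      (λ (x<y , x×y) → proj₁ (cut x<y x×y)) (λ (x<y , x×y) → proj₂ (cut x<y x×y))
      where
      cut : ∀ {x y} → x < y → Crossing (colour a) x y →
            (x ≤ toℕ i → ¬ y < toℕ k → x ≡ toℕ i × y ≡ toℕ k) × (¬ x ≤ toℕ i → y < toℕ k → ⊥)
      cut = bridgeCut (proj₂ i×k) i<k′ ik′ k′<k i′<k i′k i<i′

    centre : ∀ {i′ k′} → Crossed i k′ → Crossed i′ k → toℕ k < toℕ k′ → toℕ i′ < toℕ i → MoreThanOneDecomp S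
    centre (i<k′ , ik′) (i′<k , i′k) k<k′ i′<i =
      flippedByColour (toℕ i ≤_) (toℕ k <_) (toℕ i ≤?_) (toℕ k <?_) ≤-refl (<-irrefl refl)
                      (λ (x<y , x×y) → proj₁ (cut x<y x×y)) (λ (x<y , x×y) → proj₂ (cut x<y x×y))
      where
      cut : ∀ {x y} → x < y → Crossing (colour a) x y →
            (toℕ i ≤ x → ¬ toℕ k < y → x ≡ toℕ i × y ≡ toℕ k) × (¬ toℕ i ≤ x → toℕ k < y → ⊥)
      cut = centreCut i<k (proj₂ i×k) i<k′ ik′ k<k′ i′<k i′k i′<i

    moreThanOne : MoreThanOneDecomp S
    moreThanOne with anyFin? (λ y → ¬? (y Fin.≟ k) ×-dec crossed? i y)
                   | anyFin? (λ x → ¬? (x Fin.≟ i) ×-dec crossed? x k)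
    ... | no none | _ = onlyPartnerOfi λ y y≢k i×y → none (y , y≢k , i×y)
    ... | yes _ | no none = onlyPartnerOfk λ x x≢i x×k → none (x , x≢i , x×k)
    ... | yes (k′ , k′≢k , i×k′@(i<k′ , ik′)) | yes (i′ , i′≢i , i′×k@(i′<k , i′k))
      with otherPartners (proj₂ i×k) i<k′ ik′ i′<k i′k (k′≢k ∘ toℕ-injective) (i′≢i ∘ toℕ-injective)
    ...   | inj₁ (k′<k , i<i′) = bridge i×k′ i′×k k′<k i<i′
    ...   | inj₂ (k<k′ , i′<i) = centre i×k′ i′×k k<k′ i′<i

  maximal : ∀ S → ProperRefinement (PA a) S → MoreThanOneDecomp S
  maximal S ((S-isPartialOrder , _) , R⊆S , x , y , sxy , ¬rxy) with crossed? x y | crossed? y x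
  ... | yes x×y | _ = Refinement.moreThanOne S R⊆S x×y (inj₁ sxy)
  ... | no _ | yes y×x = Refinement.moreThanOne S R⊆S y×x (inj₂ sxy)
  ... | no ¬x×y | no ¬y×x with ¬crossed⇒comparable x y ¬x×y ¬y×x
  ...   | inj₁ rxy = contradiction rxy ¬rxy
  ...   | inj₂ ryx = contradiction (inj₁ (IsPartialOrder.antisym S-isPartialOrder sxy (R⊆S y x ryx))) ¬rxy

PA-isTwoChain : ∀ a → IsTwoChain (PA a)
PA-isTwoChain a = (PA-isPartialOrder , PA?) , uniqueColouring⇒uniqueDecomp PA-uniqueColouring , maximal
  where open WordPoset a

module TwoChain {n : ℕ} {R : FRel (suc (suc n))} (twoChain : IsTwoChain R) where

  M : ℕ
  M = suc (suc n)

  R-isPartialOrder : IsPartialOrder _≡_ R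
  R-isPartialOrder = proj₁ (proj₁ twoChain)

  R? : Decidable R
  R? = proj₂ (proj₁ twoChain)

  uniqueDecomp : UniqueDecomp R
  uniqueDecomp = proj₁ (proj₂ twoChain)

  refinements : ∀ S → ProperRefinement R S → MoreThanOneDecomp S
  refinements = proj₂ (proj₂ twoChain)

  open IsPartialOrder R-isPartialOrder using () renaming (refl to R-refl; trans to R-trans; antisym to R-antisym)

  opaque
    col : Fin M → Bool
    col = proj₁ (uniqueDecomp⇒uniqueColouring uniqueDecomp)

    chain : ChainColouring R col
    chain = proj₁ (proj₂ (uniqueDecomp⇒uniqueColouring uniqueDecomp))

    canonical : ∀ C D → Decomp R C D → SamePair (zeros col) (ones col) C D
    canonical = proj₂ (proj₂ (uniqueDecomp⇒uniqueColouring uniqueDecomp))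

  open ColourExtension R-isPartialOrder R? chain
  open Ranking _≺?_ ≺-irrefl ≺-trans ≺-total

  noRecolouring : ∀ {P : Fin M → Set} (P? : ∀ x → Dec (P x)) →
                  (∀ x y → col x ≡ false → col y ≡ true → (P x × ¬ P y) ⊎ (¬ P x × P y) → R x y ⊎ R y x) →
                  ∀ {z z′} → P z → ¬ P z′ → ⊥
  noRecolouring {P} P? separated {z} {z′} pz ¬pz′ =
    flip-notSamePair {col = col} A (dec-true (P? z) pz) (dec-false (P? z′) ¬pz′)
      (canonical _ _ (colouringDecomp (flipColouring A chain separated′)))
    where
    A : Fin M → Bool
    A x = does (P? x)
    separated′ : ∀ x y → col x ≢ col y → A x ≢ A y → R x y ⊎ R y x
    separated′ x y cx≢cy Ax≢Ay with false-or-true (col x)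
    ... | inj₁ cx = separated x y cx (¬-not (λ cy → cx≢cy (trans cx (sym cy)))) (does-≢ (P? x) (P? y) Ax≢Ay)
    ... | inj₂ cx = Sum.swap (separated y x (¬-not (λ cy → cx≢cy (trans cx (sym cy)))) cx
                               (does-≢ (P? y) (P? x) (≢-sym Ax≢Ay)))

  first last : Fin M
  first = element zero
  last = element (Fin.fromℕ (suc n))

  first≺ : ∀ {x} → x ≢ first → first ≺ x
  first≺ {x} x≢first = rank-reflects (subst (_< toℕ (rank x)) (sym (cong toℕ (rank-element zero))) (n≢0⇒n>0 rank≢0))
    where
    rank≢0 : toℕ (rank x) ≢ 0
    rank≢0 e = x≢first (trans (sym (element-rank x)) (cong element (toℕ-injective {j = zero} e)))

  ≺last : ∀ {x} → x ≢ last → x ≺ last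
  ≺last {x} x≢last = rank-reflects (subst (toℕ (rank x) <_) (sym rank-last) (≤∧≢⇒< (≤-pred (toℕ<n (rank x))) rank≢top))
    where
    rank-last : toℕ (rank last) ≡ suc n
    rank-last = trans (cong toℕ (rank-element _)) (toℕ-fromℕ (suc n))
    rank≢top : toℕ (rank x) ≢ suc n
    rank≢top e =
      x≢last (trans (sym (element-rank x)) (cong element (toℕ-injective (trans e (sym (toℕ-fromℕ (suc n)))))))

  last≢first : last ≢ first
  last≢first e =
    Fin-0≢1+n (trans (sym (rank-element zero)) (trans (cong rank (sym e)) (rank-element (Fin.fromℕ (suc n)))))

  first-colour : col first ≡ false
  first-colour with false-or-true (col first)
  ... | inj₁ c-first = c-first
  ... | inj₂ c-first = ⊥-elim (noRecolouring (Fin._≟ first) separated {first} {last} refl last≢first)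
    where
    separated : ∀ x y → col x ≡ false → col y ≡ true → (x ≡ first × y ≢ first) ⊎ (x ≢ first × y ≡ first) → R x y ⊎ R y x
    separated x y cx _ (inj₁ (refl , _)) = contradiction (trans (sym c-first) cx) λ ()
    separated x y _ _ (inj₂ (x≢first , refl)) = inj₂ (≺-fromOne⇒R c-first (first≺ x≢first))

  last-colour : col last ≡ true
  last-colour with false-or-true (col last)
  ... | inj₂ c-last = c-last
  ... | inj₁ c-last = ⊥-elim (noRecolouring (Fin._≟ last) separated {last} {first} refl (≢-sym last≢first))
    where
    separated : ∀ x y → col x ≡ false → col y ≡ true → (x ≡ last × y ≢ last) ⊎ (x ≢ last × y ≡ last) → R x y ⊎ R y x
    separated x y _ cy (inj₁ (refl , y≢last)) = inj₂ (≺-fromOne⇒R cy (≺last y≢last))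
    separated x y _ cy (inj₂ (_ , refl)) = contradiction (trans (sym cy) c-last) λ ()

  AscentFreeBetween : Fin M → Fin M → Set
  AscentFreeBetween u v = ∀ w₁ w₂ → u ≺ w₁ → w₁ ≺ w₂ → w₂ ≺ v → col w₁ ≡ false → col w₂ ≡ true → ⊥

  ≺-compare : ∀ x y → x ≡ y ⊎ x ≺ y ⊎ y ≺ x
  ≺-compare x y with x Fin.≟ y
  ... | yes x≡y = inj₁ x≡y
  ... | no x≢y = inj₂ (≺-total x y x≢y)

  -- Otherwise recolour everything from v on, together with the 0s after u.
  ascentFree⇒incomparable : ∀ {u v} → col u ≡ false → col v ≡ true → AscentFreeBetween u v → ¬ R u v
  ascentFree⇒incomparable {u} {v} cu cv free ruv = noRecolouring A? separated {v} {u} (inj₁ (inj₁ refl)) ¬Au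
    where
    A : Fin M → Set
    A z = (z ≡ v ⊎ v ≺ z) ⊎ (col z ≡ false × u ≺ z)
    A? : ∀ z → Dec (A z)
    A? z = ((z Fin.≟ v) ⊎-dec (v ≺? z)) ⊎-dec ((col z ≟𝔹 false) ×-dec (u ≺? z))
    u≺v : u ≺ v
    u≺v = inj₁ (ruv , colours-differ {c = col} cu cv)
    ¬Au : ¬ A u
    ¬Au (inj₁ (inj₁ u≡v)) = colours-differ {c = col} cu cv u≡v
    ¬Au (inj₁ (inj₂ v≺u)) = ≺-asym u≺v v≺u
    ¬Au (inj₂ (_ , u≺u)) = ≺-irrefl u≺u
    separated : ∀ x y → col x ≡ false → col y ≡ true → (A x × ¬ A y) ⊎ (¬ A x × A y) → R x y ⊎ R y x
    separated x y cx cy (inj₂ (¬Ax , Ay)) = inj₁ (R-trans (R-trans x≤u ruv) v≤y)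
      where
      x≤u : R x u
      x≤u = [ (λ x≡u → subst (λ z → R z u) (sym x≡u) R-refl)
            , [ ≺-sameColour⇒R (trans cx (sym cu)) , (λ u≺x → ⊥-elim (¬Ax (inj₂ (cx , u≺x)))) ]′ ]′ (≺-compare x u)
      v≤y : R v y
      v≤y = [ [ (λ y≡v → subst (R v) (sym y≡v) R-refl) , ≺-fromOne⇒R cv ]′
            , (λ (cy′ , _) → contradiction (trans (sym cy) cy′) λ ()) ]′ Ay
    separated x y cx cy (inj₁ (Ax , ¬Ay)) with incomparable? x y
    ... | inj₁ r = inj₁ r
    ... | inj₂ (inj₁ r) = inj₂ r
    ... | inj₂ (inj₂ x∥y) = ⊥-elim (stuck Ax)
      where
      x≺y : x ≺ y
      x≺y = inj₂ (x∥y , cx)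
      y≺v : y ≺ v
      y≺v with ≺-compare y v
      ... | inj₁ y≡v = ⊥-elim (¬Ay (inj₁ (inj₁ y≡v)))
      ... | inj₂ (inj₁ y≺v) = y≺v
      ... | inj₂ (inj₂ v≺y) = ⊥-elim (¬Ay (inj₁ (inj₂ v≺y)))
      stuck : A x → ⊥
      stuck (inj₁ (inj₁ x≡v)) = colours-differ {c = col} cx cv x≡v
      stuck (inj₁ (inj₂ v≺x)) = ≺-irrefl (≺-trans v≺x (≺-trans x≺y y≺v))
      stuck (inj₂ (_ , u≺x)) = free x y u≺x x≺y y≺v cx cy

  -- A 2×2 block u ≺ w₁ ≺ w₂ ≺ v (colours 0,0,1,1) with u ∥ v contradicts
  -- maximality: the pair xs ∥ ys found below can be made comparable
  -- without creating a new decomposition.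
  module Block {u v w₁ w₂ : Fin M} (cu : col u ≡ false) (cv : col v ≡ true) (u∥v : Incomparable u v)
               (u≺w₁ : u ≺ w₁) (w₁≺w₂ : w₁ ≺ w₂) (w₂≺v : w₂ ≺ v) (cw₁ : col w₁ ≡ false) (cw₂ : col w₂ ≡ true) where

    u≰v : ¬ R u v
    u≰v = proj₁ u∥v

    v≰u : ¬ R v u
    v≰u = proj₂ u∥v

    u≤w₁ : R u w₁
    u≤w₁ = ≺-sameColour⇒R (trans cu (sym cw₁)) u≺w₁

    w₂≤v : R w₂ v
    w₂≤v = ≺-sameColour⇒R (trans cw₂ (sym cv)) w₂≺v

    w₁≰w₂ : ¬ R w₁ w₂
    w₁≰w₂ r = u≰v (R-trans u≤w₁ (R-trans r w₂≤v))

    w₂≰w₁ : ¬ R w₂ w₁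
    w₂≰w₁ = [ (λ (r , _) → ⊥-elim (w₁≰w₂ r)) , (λ ((_ , w₂≰w₁) , _) → w₂≰w₁) ]′ w₁≺w₂

    beside? : ∀ b w c → Dec (col c ≡ b × Incomparable c w)
    beside? b w c = (col c ≟𝔹 b) ×-dec (¬? (R? c w) ×-dec ¬? (R? w c))

    ys-max : ∃[ y ] (col y ≡ false × Incomparable y w₂) × (∀ c → col c ≡ false × Incomparable c w₂ → ¬ y ≺ c)
    ys-max = maximalIn (beside? false w₂) (cw₁ , w₁≰w₂ , w₂≰w₁)

    ys : Fin M
    ys = proj₁ ys-max

    cys : col ys ≡ false
    cys = proj₁ (proj₁ (proj₂ ys-max))

    ys∥w₂ : Incomparable ys w₂
    ys∥w₂ = proj₂ (proj₁ (proj₂ ys-max))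

    xs-min : ∃[ x ] (col x ≡ true × Incomparable x ys) × (∀ d → col d ≡ true × Incomparable d ys → ¬ d ≺ x)
    xs-min = minimalIn (beside? true ys) (cw₂ , proj₂ ys∥w₂ , proj₁ ys∥w₂)

    xs : Fin M
    xs = proj₁ xs-min

    cxs : col xs ≡ true
    cxs = proj₁ (proj₁ (proj₂ xs-min))

    xs≰ys : ¬ R xs ys
    xs≰ys = proj₁ (proj₂ (proj₁ (proj₂ xs-min)))

    ys≰xs : ¬ R ys xs
    ys≰xs = proj₂ (proj₂ (proj₁ (proj₂ xs-min)))

    w₁≤ys : R w₁ ys
    w₁≤ys with chain w₁ ys (trans cw₁ (sym cys))
    ... | inj₁ r = r
    ... | inj₂ r with ys Fin.≟ w₁
    ...   | yes ys≡w₁ = subst (R w₁) (sym ys≡w₁) R-refl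
    ...   | no ys≢w₁ = ⊥-elim (proj₂ (proj₂ ys-max) w₁ (cw₁ , w₁≰w₂ , w₂≰w₁) (inj₁ (r , ys≢w₁)))

    xs≤w₂ : R xs w₂
    xs≤w₂ with chain xs w₂ (trans cxs (sym cw₂))
    ... | inj₁ r = r
    ... | inj₂ r with w₂ Fin.≟ xs
    ...   | yes w₂≡xs = subst (λ z → R z w₂) w₂≡xs R-refl
    ...   | no w₂≢xs = ⊥-elim (proj₂ (proj₂ xs-min) w₂ (cw₂ , proj₂ ys∥w₂ , proj₁ ys∥w₂) (inj₁ (r , w₂≢xs)))

    u≢ys : u ≢ ys
    u≢ys u≡ys = ≺-irrefl (subst (u ≺_) (trans (R-antisym w₁≤ys (subst (λ z → R z w₁) u≡ys u≤w₁)) (sym u≡ys)) u≺w₁)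

    v≢xs : v ≢ xs
    v≢xs v≡xs = ≺-irrefl (subst (_≺ v) (trans (sym (R-antisym xs≤w₂ (subst (R w₂) v≡xs w₂≤v))) (sym v≡xs)) w₂≺v)

    S : FRel M
    S p q = R p q ⊎ (R p xs × R ys q)

    S-new : ∀ {p q} → S p q → ¬ R p q → ¬ R q p → p ≡ xs × q ≡ ys
    S-new (inj₁ r) p≰q _ = ⊥-elim (p≰q r)
    S-new {p} {q} (inj₂ (p≤xs , ys≤q)) p≰q q≰p with false-or-true (col p)
    ... | inj₁ cp = ⊥-elim ([ (λ p≤ys → p≰q (R-trans p≤ys ys≤q)) , (λ ys≤p → ys≰xs (R-trans ys≤p p≤xs)) ]′
                              (chain p ys (trans cp (sym cys))))
    ... | inj₂ cp with p Fin.≟ xs | q Fin.≟ ys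
    ...   | yes p≡xs | yes q≡ys = p≡xs , q≡ys
    ...   | no p≢xs | _ =
            ⊥-elim (proj₂ (proj₂ xs-min) p (cp , (λ r → p≰q (R-trans r ys≤q)) , (λ r → ys≰xs (R-trans r p≤xs)))
                                           (inj₁ (p≤xs , p≢xs)))
    ...   | yes p≡xs | no q≢ys =
            ⊥-elim (proj₂ (proj₂ ys-max) q (cq , (λ r → proj₁ ys∥w₂ (R-trans ys≤q r)) , w₂≰q) (inj₁ (ys≤q , ≢-sym q≢ys)))
      where
      cq : col q ≡ false
      cq = trans (incomparable⇒opposite (q≰p , p≰q)) (cong not cp)
      w₂≰q : ¬ R w₂ q
      w₂≰q r = p≰q (subst (λ z → R z q) (sym p≡xs) (R-trans xs≤w₂ r))

    S-newComparable : ∀ {p q} → S p q ⊎ S q p → ¬ R p q → ¬ R q p → (p ≡ xs × q ≡ ys) ⊎ (q ≡ xs × p ≡ ys)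
    S-newComparable (inj₁ s) p≰q q≰p = inj₁ (S-new s p≰q q≰p)
    S-newComparable (inj₂ s) p≰q q≰p = inj₂ (S-new s q≰p p≰q)

    S-trans : ∀ {p q r} → S p q → S q r → S p r
    S-trans (inj₁ pq) (inj₁ qr) = inj₁ (R-trans pq qr)
    S-trans (inj₁ pq) (inj₂ (q≤xs , ys≤r)) = inj₂ (R-trans pq q≤xs , ys≤r)
    S-trans (inj₂ (p≤xs , ys≤q)) (inj₁ qr) = inj₂ (p≤xs , R-trans ys≤q qr)
    S-trans (inj₂ (_ , ys≤q)) (inj₂ (q≤xs , _)) = ⊥-elim (ys≰xs (R-trans ys≤q q≤xs))

    S-antisym : ∀ {p q} → S p q → S q p → p ≡ q
    S-antisym (inj₁ pq) (inj₁ qp) = R-antisym pq qp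
    S-antisym (inj₁ pq) (inj₂ (q≤xs , ys≤p)) = ⊥-elim (ys≰xs (R-trans ys≤p (R-trans pq q≤xs)))
    S-antisym (inj₂ (p≤xs , ys≤q)) (inj₁ qp) = ⊥-elim (ys≰xs (R-trans ys≤q (R-trans qp p≤xs)))
    S-antisym (inj₂ (_ , ys≤q)) (inj₂ (q≤xs , _)) = ⊥-elim (ys≰xs (R-trans ys≤q q≤xs))

    S-refines : ProperRefinement R S
    S-refines = ( record { isPreorder = record { isEquivalence = isEquivalence
                                               ; reflexive = λ { refl → inj₁ R-refl }
                                               ; trans = S-trans }
                         ; antisym = S-antisym }
                , λ p q → R? p q ⊎-dec (R? p xs ×-dec R? ys q))
              , (λ _ _ → inj₁) , xs , ys , inj₂ (R-refl , R-refl) , xs≰ys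

    u≰xs : ¬ R u xs
    u≰xs r = u≰v (R-trans r (R-trans xs≤w₂ w₂≤v))

    xs≰u : ¬ R xs u
    xs≰u r = xs≰ys (R-trans r (R-trans u≤w₁ w₁≤ys))

    v≰ys : ¬ R v ys
    v≰ys r = xs≰ys (R-trans xs≤w₂ (R-trans w₂≤v r))

    ys≰v : ¬ R ys v
    ys≰v r = u≰v (R-trans u≤w₁ (R-trans w₁≤ys r))

    u∉ : ∀ {Z} → IsChain S Z → xs ∈ Z → u ∉ Z
    u∉ chainZ xs∈Z u∈Z = [ (λ (u≡xs , _) → colours-differ {c = col} cu cxs u≡xs) , (λ (_ , u≡ys) → u≢ys u≡ys) ]′
                           (S-newComparable (chainZ u xs u∈Z xs∈Z) u≰xs xs≰u)

    v∉ : ∀ {Z} → IsChain S Z → ys ∈ Z → v ∉ Z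
    v∉ chainZ ys∈Z v∈Z = [ (λ (v≡xs , _) → v≢xs v≡xs) , (λ (ys≡xs , _) → colours-differ {c = col} cys cxs ys≡xs) ]′
                           (S-newComparable (chainZ v ys v∈Z ys∈Z) v≰ys ys≰v)

    -- u and v would both have to lie in the other chain, but stay S-incomparable.
    apart : ∀ {Z Z′} → IsChain S Z → IsChain S Z′ → (∀ w → w ∈ Z ⊎ w ∈ Z′) → ¬ (xs ∈ Z × ys ∈ Z)
    apart {Z} {Z′} chainZ chainZ′ cover (xs∈Z , ys∈Z) =
      [ (λ (u≡xs , _) → colours-differ {c = col} cu cxs u≡xs) , (λ (v≡xs , _) → v≢xs v≡xs) ]′
      (S-newComparable (chainZ′ u v (other (u∉ chainZ xs∈Z)) (other (v∉ chainZ ys∈Z))) u≰v v≰u)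
      where
      other : ∀ {w} → w ∉ Z → w ∈ Z′
      other {w} w∉Z = [ (λ w∈Z → ⊥-elim (w∉Z w∈Z)) , (λ w∈Z′ → w∈Z′) ]′ (cover w)

    S-chain⇒R-chain : ∀ {Z} → IsChain S Z → ¬ (xs ∈ Z × ys ∈ Z) → IsChain R Z
    S-chain⇒R-chain {Z} chainZ ¬both p q p∈Z q∈Z =
      [ inj₁ , [ inj₂ , (λ p∥q → ⊥-elim (¬both (bothIn p∥q))) ]′ ]′ (incomparable? p q)
      where
      bothIn : Incomparable p q → xs ∈ Z × ys ∈ Z
      bothIn (p≰q , q≰p) = [ (λ (p≡xs , q≡ys) → subst (_∈ Z) p≡xs p∈Z , subst (_∈ Z) q≡ys q∈Z)
                           , (λ (q≡xs , p≡ys) → subst (_∈ Z) q≡xs q∈Z , subst (_∈ Z) p≡ys p∈Z) ]′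
                           (S-newComparable (chainZ p q p∈Z q∈Z) p≰q q≰p)

    S-decomp⇒canonical : ∀ X Y → Decomp S X Y → SamePair (zeros col) (ones col) X Y
    S-decomp⇒canonical X Y (chainX , chainY , cover) =
      canonical X Y ( S-chain⇒R-chain chainX (apart chainX chainY covered)
                    , S-chain⇒R-chain chainY (apart chainY chainX (λ w → Sum.swap (covered w)))
                    , cover)
      where
      covered : ∀ w → w ∈ X ⊎ w ∈ Y
      covered w = x∈p∪q⁻ X Y (subst (w ∈_) (sym cover) ∈⊤)

    impossible : ⊥
    impossible with refinements S S-refines
    ... | C₁ , D₁ , C₂ , D₂ , d₁ , d₂ , different =
          different (samePair-trans (S-decomp⇒canonical C₁ D₁ d₁) (S-decomp⇒canonical C₂ D₂ d₂))

  incomparable⇒ascentFree : ∀ {u v} → col u ≡ false → col v ≡ true → Incomparable u v → AscentFreeBetween u v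
  incomparable⇒ascentFree cu cv u∥v w₁ w₂ u≺w₁ w₁≺w₂ w₂≺v cw₁ cw₂ =
    Block.impossible cu cv u∥v u≺w₁ w₁≺w₂ w₂≺v cw₁ cw₂

  -- The word read off along ≺

  -- The colour of the element of rank t (the value for t ≥ M is never used).
  colourOfRank : ℕ → Bool
  colourOfRank t with t <? M
  ... | yes t<M = col (element (fromℕ< t<M))
  ... | no _ = true

  word : List Bool
  word = applyUpTo (λ j → colourOfRank (suc j)) n

  length-word : length word ≡ n
  length-word = length-applyUpTo _ n

  colour-word : ∀ t (t<M : t < M) → colour word t ≡ col (element (fromℕ< t<M))
  colour-word zero _ = sym first-colour
  colour-word (suc t) (s≤s t<1+n) with m≤n⇒m<n∨m≡n (≤-pred t<1+n)
  ... | inj₁ t<n = trans (colour-applyUpTo _ n t t<n) colourOfRank-1+t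
    where
    colourOfRank-1+t : colourOfRank (suc t) ≡ col (element (suc (fromℕ< t<1+n)))
    colourOfRank-1+t with suc t <? M
    ... | yes _ = refl
    ... | no 1+t≮M = contradiction (s≤s t<1+n) 1+t≮M
  ... | inj₂ refl = begin
    colour word (suc t)            ≡⟨ cong (λ k → colour word (suc k)) (sym length-word) ⟩
    colour word (suc (length word)) ≡⟨ colour-last word ⟩
    true                           ≡⟨ sym last-colour ⟩
    col last                       ≡⟨ cong (λ p → col (element p))
                                           (toℕ-injective (trans (toℕ-fromℕ (suc t)) (sym (toℕ-fromℕ< (s≤s t<1+n))))) ⟩
    col (element (suc (fromℕ< t<1+n))) ∎
    where open ≡-Reasoning

  colour-rank : ∀ u → colour word (toℕ (rank u)) ≡ col u
  colour-rank u =
    trans (colour-word _ (toℕ<n (rank u))) (cong col (trans (cong element (fromℕ<-toℕ (rank u) _)) (element-rank u)))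

  noAscent⇒ascentFree : ∀ {u v} → NoAscentBetween (colour word) (toℕ (rank u)) (toℕ (rank v)) → AscentFreeBetween u v
  noAscent⇒ascentFree gap w₁ w₂ u≺w₁ w₁≺w₂ w₂≺v cw₁ cw₂ =
    gap _ _ (rank-mono u≺w₁) (rank-mono w₁≺w₂) (rank-mono w₂≺v)
            (trans (colour-rank w₁) cw₁) (trans (colour-rank w₂) cw₂)

  ascentFree⇒noAscent : ∀ {u v} → AscentFreeBetween u v → NoAscentBetween (colour word) (toℕ (rank u)) (toℕ (rank v))
  ascentFree⇒noAscent {u} {v} free k l u<k k<l l<v ck cl =
    free (element (fromℕ< k<M)) (element (fromℕ< l<M))
         (rank-reflects (subst (toℕ (rank u) <_) (sym (toℕ-rank-element k<M)) u<k))
         (rank-reflects (subst₂ _<_ (sym (toℕ-rank-element k<M)) (sym (toℕ-rank-element l<M)) k<l))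
         (rank-reflects (subst (_< toℕ (rank v)) (sym (toℕ-rank-element l<M)) l<v))
         (trans (sym (colour-word k k<M)) ck) (trans (sym (colour-word l l<M)) cl)
    where
    l<M : l < M
    l<M = <-trans l<v (toℕ<n (rank v))
    k<M : k < M
    k<M = <-trans k<l l<M

  module W = WordPoset word

  M≡ : M ≡ W.N
  M≡ = cong (λ k → suc (suc k)) (sym length-word)

  position : Fin M → Fin W.N
  position u = cast M≡ (rank u)

  toℕ-position : ∀ u → toℕ (position u) ≡ toℕ (rank u)
  toℕ-position u = toℕ-cast M≡ (rank u)

  position-injective : ∀ {u v} → position u ≡ position v → u ≡ v
  position-injective {u} {v} e =
    rank-injective (toℕ-injective (trans (sym (toℕ-position u)) (trans (cong toℕ e) (toℕ-position v))))

  position-surjective : ∀ y → ∃[ u ] ∀ {z} → z ≡ u → position z ≡ y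
  position-surjective y =
    element (fromℕ< y<M) , λ { refl → toℕ-injective (trans (toℕ-position _) (toℕ-rank-element y<M)) }
    where
    y<M : toℕ y < M
    y<M = subst (toℕ y <_) (sym M≡) (toℕ<n y)

  R⇒PA : ∀ {u v} → R u v → PA word (position u) (position v)
  R⇒PA {u} {v} r with u Fin.≟ v
  ... | yes refl = inj₁ refl
  ... | no u≢v =
        W.<∧¬crossing⇒PA (subst₂ _<_ (sym (toℕ-position u)) (sym (toℕ-position v)) (rank-mono (inj₁ (r , u≢v))))
                         ¬crossing
    where
    ¬crossing : ¬ Crossing (colour word) (toℕ (position u)) (toℕ (position v))
    ¬crossing crossing with subst₂ (Crossing (colour word)) (toℕ-position u) (toℕ-position v) crossing
    ... | cu , cv , gap = ascentFree⇒incomparable (trans (sym (colour-rank u)) cu) (trans (sym (colour-rank v)) cv)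
                                                   (noAscent⇒ascentFree gap) r

  PA⇒R : ∀ {u v} → PA word (position u) (position v) → R u v
  PA⇒R {u} (inj₁ e) = subst (R u) (position-injective e) R-refl
  PA⇒R {u} {v} p@(inj₂ (lt , _)) with rank-reflects (subst₂ _<_ (toℕ-position u) (toℕ-position v) lt)
  ... | inj₁ (r , _) = r
  ... | inj₂ ((u≰v , v≰u) , cu) = ⊥-elim (W.PA⇒¬crossed p (lt , crossing))
    where
    cv : col v ≡ true
    cv = trans (incomparable⇒opposite (v≰u , u≰v)) (cong not cu)
    crossing : Crossing (colour word) (toℕ (position u)) (toℕ (position v))
    crossing = subst₂ (Crossing (colour word)) (sym (toℕ-position u)) (sym (toℕ-position v))
      ( trans (colour-rank u) cu , trans (colour-rank v) cv
      , ascentFree⇒noAscent (incomparable⇒ascentFree cu cv (u≰v , v≰u)))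

  isomorphic : Iso R (PA word)
  isomorphic = position , (position-injective , position-surjective) , λ u v → mk⇔ R⇒PA PA⇒R

twoChain⇒isomorphic : ∀ n (R : FRel (suc (suc n))) → IsTwoChain R → ∃[ a ] Iso R (PA a)
twoChain⇒isomorphic n R twoChain = TwoChain.word twoChain , TwoChain.isomorphic twoChain

module _ {c : ℕ → Bool} where

  MirrorOfZero : ℕ → ℕ → ℕ → Set
  MirrorOfZero t p r = p < r × r ≤ t × (c r ≡ false ⊎ r ≡ t) × (∀ l → p < l → l < r → c l ≡ true)

  MirrorOfOne : ℕ → ℕ → Set
  MirrorOfOne p r = r < p × (c r ≡ true ⊎ r ≡ 0) × (∀ l → r < l → l < p → c l ≡ false)

  mirrors-zero-zero : ∀ {t p q r s} → MirrorOfZero t p r → MirrorOfZero t q s → p < q → c q ≡ false → r < s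
  mirrors-zero-zero {q = q} {r} (p<r , _ , _ , ones) (q<s , _) p<q cq = ≤-<-trans r≤q q<s
    where
    r≤q : r ≤ q
    r≤q with r ≤? q
    ... | yes r≤q = r≤q
    ... | no r≰q with trans (sym (ones q p<q (≰⇒> r≰q))) cq
    ...   | ()

  mirrors-one-one : ∀ {p q r s} → MirrorOfOne p r → MirrorOfOne q s → p < q → c p ≡ true → r < s
  mirrors-one-one {p} {s = s} (r<p , _) (_ , _ , zeros) p<q cp = <-≤-trans r<p p≤s
    where
    p≤s : p ≤ s
    p≤s with p ≤? s
    ... | yes p≤s = p≤s
    ... | no p≰s with trans (sym cp) (zeros p (≰⇒> p≰s) p<q)
    ...   | ()

  mirrors-one-zero : ∀ {t p q r s} → MirrorOfOne p r → MirrorOfZero t q s → p < q → r < s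
  mirrors-one-zero (r<p , _) (q<s , _) p<q = <-trans r<p (<-trans p<q q<s)

  mirrors-zero-one : ∀ {t p q r s} → MirrorOfZero t p r → MirrorOfOne q s →
                     ¬ NoAscentBetween c p q → r < s
  mirrors-zero-one {p = p} {q} {r} {s} (_ , _ , _ , ones) (_ , _ , zeros) ascent with r <? s
  ... | yes r<s = r<s
  ... | no r≮s = ⊥-elim (ascent noAscent)
    where
    noAscent : NoAscentBetween c p q
    noAscent k l p<k k<l l<q ck cl with k <? r | s <? l
    ... | yes k<r | _ with trans (sym ck) (ones k p<k k<r)
    ...   | ()
    noAscent k l p<k k<l l<q ck cl | _ | yes s<l with trans (sym cl) (zeros l s<l l<q)
    ...   | ()
    noAscent k l p<k k<l l<q ck cl | no k≮r | no s≮l =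
      r≮s (≤-<-trans (≮⇒≥ k≮r) (<-≤-trans k<l (≮⇒≥ s≮l)))

  mirrors-crossing : ∀ {t p q r s} → p ≤ t → MirrorOfOne p r → MirrorOfZero t q s → q < p → Crossing c q p → r < s
  mirrors-crossing {p = p} {q} {r} {s} p≤t (r<p , one-r , _) (q<s , _ , zero-s , _) q<p (_ , _ , gap) with r <? s
  ... | yes r<s = r<s
  ... | no r≮s = ⊥-elim (gap s r q<s s<r r<p cs cr)
    where
    s≤r : s ≤ r
    s≤r = ≮⇒≥ r≮s
    cs : c s ≡ false
    cs = [ (λ cs → cs) , (λ { refl → ⊥-elim (<-irrefl refl (≤-<-trans s≤r (<-≤-trans r<p p≤t))) }) ]′ zero-s
    cr : c r ≡ true
    cr = [ (λ cr → cr) , (λ { refl → ⊥-elim (<-irrefl refl (<-≤-trans (≤-<-trans z≤n q<s) s≤r)) }) ]′ one-r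
    s<r : s < r
    s<r = ≤∧≢⇒< s≤r (colours-differ cs cr)

module Isomorphic (a b : List Bool) (iso : Iso (PA a) (PA b)) where

  module A = WordPoset a
  module B = WordPoset b

  f : Fin A.N → Fin B.N
  f = proj₁ iso

  f-injective : ∀ {x y} → f x ≡ f y → x ≡ y
  f-injective = proj₁ (proj₁ (proj₂ iso))

  f-surjective : ∀ y → ∃[ x ] (∀ {z} → z ≡ x → f z ≡ y)
  f-surjective = proj₂ (proj₁ (proj₂ iso))

  f-iso : ∀ x y → PA a x y ⇔ PA b (f x) (f y)
  f-iso = proj₂ (proj₂ iso)

  g : Fin B.N → Fin A.N
  g y = proj₁ (f-surjective y)

  f∘g : ∀ y → f (g y) ≡ y
  f∘g y = proj₂ (f-surjective y) refl

  g-injective : ∀ {y y′} → g y ≡ g y′ → y ≡ y′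
  g-injective {y} {y′} e = trans (sym (f∘g y)) (trans (cong f e) (f∘g y′))

  g∘f : ∀ x → g (f x) ≡ x
  g∘f x = f-injective (f∘g (f x))

  f-mono : ∀ {x y} → PA a x y → PA b (f x) (f y)
  f-mono {x} {y} = Equivalence.to (f-iso x y)

  f-reflects : ∀ {x y} → PA b (f x) (f y) → PA a x y
  f-reflects {x} {y} = Equivalence.from (f-iso x y)

  length≡ : length b ≡ length a
  length≡ = suc-injective (suc-injective (≤-antisym (injective⇒≤ g-injective) (injective⇒≤ f-injective)))

  g-chainColouring : ChainColouring (PA b) (A.col ∘′ g)
  g-chainColouring y y′ same with A.sameColour⇒comparable (g y) (g y′) same
  ... | inj₁ r = inj₁ (subst₂ (PA b) (f∘g y) (f∘g y′) (f-mono r))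
  ... | inj₂ r = inj₂ (subst₂ (PA b) (f∘g y′) (f∘g y) (f-mono r))

  sameOrSwapped : (∀ x → B.col (f x) ≡ A.col x) ⊎ (∀ x → B.col (f x) ≡ not (A.col x))
  sameOrSwapped with samePair⇒same-or-opposite {c = B.col} {d = A.col ∘′ g}
                       (proj₂ B.PA-uniqueColouring _ _ (colouringDecomp g-chainColouring))
  ... | inj₁ same = inj₁ λ x → sym (trans (cong A.col (sym (g∘f x))) (same (f x)))
  ... | inj₂ opposite = inj₂ λ x → trans (sym (not-involutive _))
                                   (cong not (sym (trans (cong A.col (sym (g∘f x))) (opposite (f x)))))

  f-<-comparable : ∀ {x y} → PA a x y → x ≢ y → toℕ (f x) < toℕ (f y)
  f-<-comparable r x≢y = B.PA∧≢⇒< (f-mono r) (x≢y ∘′ f-injective)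

  f-<-incomparable : ∀ {x y} → ¬ PA a x y → ¬ PA a y x → B.col (f x) ≡ false → toℕ (f x) < toℕ (f y)
  f-<-incomparable x≰y y≰x cfx = proj₁ (B.incomparable⇒crossed (x≰y ∘′ f-reflects) (y≰x ∘′ f-reflects) cfx)

  N≡ : A.N ≡ B.N
  N≡ = cong (λ n → suc (suc n)) (sym length≡)

  colour-b : ∀ t (t<N : t < B.N) → colour b t ≡ B.col (fromℕ< t<N)
  colour-b t t<N = cong (colour b) (sym (toℕ-fromℕ< t<N))

  module SameColours (same : ∀ x → B.col (f x) ≡ A.col x) where

    f-increasing : ∀ {x y} → toℕ x < toℕ y → toℕ (f x) < toℕ (f y)
    f-increasing {x} {y} x<y with A.crossed? x y
    ... | no ¬x×y =
      f-<-comparable (A.<∧¬crossing⇒PA x<y λ crossing → ¬x×y (x<y , crossing)) λ { refl → <-irrefl refl x<y }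
    ... | yes x×y@(_ , cx , _) =
      f-<-incomparable (λ r → A.PA⇒¬crossed r x×y) (λ r → A.comparable⇒¬crossed (inj₂ r) x×y) (trans (same x) cx)

    b≡a : b ≡ a
    b≡a = colour-injective a b length≡ λ t t<N → let y = fromℕ< t<N ; x = g y in begin
      colour b t             ≡⟨ colour-b t t<N ⟩
      B.col y                ≡⟨ cong B.col (sym (f∘g y)) ⟩
      B.col (f x)            ≡⟨ same x ⟩
      colour a (toℕ x)       ≡⟨ cong (colour a) (sym (strictlyIncreasing⇒toℕ-id N≡ f f-increasing x)) ⟩
      colour a (toℕ (f x))   ≡⟨ cong (λ z → colour a (toℕ z)) (f∘g y) ⟩
      colour a (toℕ y)       ≡⟨ cong (colour a) (toℕ-fromℕ< t<N) ⟩
      colour a t             ∎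
      where open ≡-Reasoning

  -- Both f and mirror turn the order ≺ (1s before 0s among incomparable pairs)
  -- into the order of positions; hence mirror ∘ g is strictly increasing, so
  -- it is the identity, and b is read off as the complement of a.
  module SwappedColours (swapped : ∀ x → B.col (f x) ≡ not (A.col x)) where

    not-chainColouring : ChainColouring (PA a) (not ∘′ A.col)
    not-chainColouring x y same = A.sameColour⇒comparable x y (not-injective same)

    open ColourExtension A.PA-isPartialOrder A.PA? not-chainColouring

    f-≺ : ∀ {u v} → u ≺ v → toℕ (f u) < toℕ (f v)
    f-≺ (inj₁ (r , u≢v)) = f-<-comparable r u≢v
    f-≺ {u} (inj₂ ((u≰v , v≰u) , cu)) = f-<-incomparable u≰v v≰u (trans (swapped u) cu)

    top : ℕ
    top = suc (length a)

    Mirror : Fin A.N → ℕ → Set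
    Mirror x r = (A.col x ≡ false → MirrorOfZero {c = colour a} top (toℕ x) r)
               × (A.col x ≡ true → MirrorOfOne {c = colour a} (toℕ x) r)

    opaque
      mirror : ∀ x → ∃[ r ] Mirror x r
      mirror x with false-or-true (A.col x)
      ... | inj₁ cx with least (λ l → (toℕ x <? l) ×-dec ((colour a l ≟𝔹 false) ⊎-dec (l ≟ top)))
                               (A.zero⇒<last {x} cx , inj₂ refl)
      ...   | r , r≤top , (x<r , end) , before =
              r , (λ _ → x<r , r≤top , end , λ l x<l l<r → ¬-not λ cl → before l l<r (x<l , inj₁ cl))
                , (λ cx′ → contradiction (trans (sym cx) cx′) λ ())
      mirror x | inj₂ cx with lastBelow (λ l → (colour a l ≟𝔹 true) ⊎-dec (l ≟ 0))
                                        (n≢0⇒n>0 (≢-sym (colours-differ {c = colour a} refl cx))) (inj₂ refl)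
      ...   | r , r<x , end , after =
              r , (λ cx′ → contradiction (trans (sym cx′) cx) λ ())
                , (λ _ → r<x , end , λ l r<l l<x → ¬-not λ cl → after l r<l l<x (inj₁ cl))

    mirror-zero : ∀ {x} → A.col x ≡ false → MirrorOfZero {c = colour a} top (toℕ x) (proj₁ (mirror x))
    mirror-zero {x} = proj₁ (proj₂ (mirror x))

    mirror-one : ∀ {x} → A.col x ≡ true → MirrorOfOne {c = colour a} (toℕ x) (proj₁ (mirror x))
    mirror-one {x} = proj₂ (proj₂ (mirror x))

    mirror<N : ∀ x → proj₁ (mirror x) < A.N
    mirror<N x = [ (λ cx → s≤s (proj₁ (proj₂ (mirror-zero cx))))
                 , (λ cx → <-trans (proj₁ (mirror-one cx)) (toℕ<n x)) ]′ (false-or-true (A.col x))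

    mirror-colour : ∀ x → colour (complement a) (proj₁ (mirror x)) ≡ not (A.col x)
    mirror-colour x =
      [ (λ cx → ofZero cx (mirror-zero cx)) , (λ cx → ofOne cx (mirror-one cx)) ]′ (false-or-true (A.col x))
      where
      r : ℕ
      r = proj₁ (mirror x)
      ofZero : A.col x ≡ false → MirrorOfZero {c = colour a} top (toℕ x) r → colour (complement a) r ≡ not (A.col x)
      ofZero cx (_ , _ , inj₂ r≡top , _) =
        trans (cong (colour (complement a)) r≡top) (trans (colour-complement-last a) (cong not (sym cx)))
      ofZero cx (x<r , r≤top , inj₁ cr , _) =
        trans (colour-complement a r (≤-<-trans z≤n x<r) r<top) (cong not (trans cr (sym cx)))
        where
        r<top : r < top
        r<top = ≤∧≢⇒< r≤top λ r≡top → colours-differ {c = colour a} cr (colour-last a) r≡top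
      ofOne : A.col x ≡ true → MirrorOfOne {c = colour a} (toℕ x) r → colour (complement a) r ≡ not (A.col x)
      ofOne cx (_ , inj₂ r≡0 , _) = trans (cong (colour (complement a)) r≡0) (cong not (sym cx))
      ofOne cx (r<x , inj₁ cr , _) =
        trans (colour-complement a r (n≢0⇒n>0 (≢-sym (colours-differ {c = colour a} refl cr)))
                                     (<-≤-trans r<x (≤-pred (toℕ<n x))))
              (cong not (trans cr (sym cx)))

    mirror-≺ : ∀ {u v} → u ≺ v → proj₁ (mirror u) < proj₁ (mirror v)
    mirror-≺ {u} {v} (inj₁ (r , u≢v)) with false-or-true (A.col u) | false-or-true (A.col v)
    ... | inj₁ cu | inj₁ cv = mirrors-zero-zero (mirror-zero cu) (mirror-zero cv) (A.PA∧≢⇒< r u≢v) cv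
    ... | inj₂ cu | inj₂ cv = mirrors-one-one (mirror-one cu) (mirror-one cv) (A.PA∧≢⇒< r u≢v) cu
    ... | inj₂ cu | inj₁ cv = mirrors-one-zero (mirror-one cu) (mirror-zero cv) (A.PA∧≢⇒< r u≢v)
    ... | inj₁ cu | inj₂ cv = mirrors-zero-one (mirror-zero cu) (mirror-one cv)
                                λ gap → A.PA⇒¬crossed r (A.PA∧≢⇒< r u≢v , cu , cv , gap)
    mirror-≺ {u} {v} (inj₂ ((u≰v , v≰u) , cu)) with false-or-true (A.col v)
    ... | inj₂ cv = ⊥-elim ([ u≰v , v≰u ]′ (A.sameColour⇒comparable u v (trans (not-injective cu) (sym cv))))
    ... | inj₁ cv with A.incomparable⇒crossed v≰u u≰v cv
    ...   | v<u , crossing =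
            mirrors-crossing (≤-pred (toℕ<n u)) (mirror-one (not-injective cu)) (mirror-zero cv) v<u crossing

    mirrorOfPreimage : Fin B.N → Fin A.N
    mirrorOfPreimage y = fromℕ< (mirror<N (g y))

    mirrorOfPreimage-increasing : ∀ {y y′} → toℕ y < toℕ y′ → toℕ (mirrorOfPreimage y) < toℕ (mirrorOfPreimage y′)
    mirrorOfPreimage-increasing {y} {y′} y<y′ =
      subst₂ _<_ (sym (toℕ-fromℕ< (mirror<N (g y)))) (sym (toℕ-fromℕ< (mirror<N (g y′))))
                 (ordered (≺-total (g y) (g y′) gy≢gy′))
      where
      gy≢gy′ : g y ≢ g y′
      gy≢gy′ e = <-irrefl (cong toℕ (g-injective e)) y<y′
      ordered : g y ≺ g y′ ⊎ g y′ ≺ g y → proj₁ (mirror (g y)) < proj₁ (mirror (g y′))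
      ordered (inj₁ gy≺gy′) = mirror-≺ gy≺gy′
      ordered (inj₂ gy′≺gy) = ⊥-elim (<-asym y<y′ (subst₂ _<_ (cong toℕ (f∘g y′)) (cong toℕ (f∘g y)) (f-≺ gy′≺gy)))

    b≡¬a : b ≡ complement a
    b≡¬a = colour-injective (complement a) b (trans length≡ (sym (length-map not a))) λ t t<N →
      let y = fromℕ< t<N ; x = g y in begin
      colour b t                                          ≡⟨ colour-b t t<N ⟩
      B.col y                                             ≡⟨ cong B.col (sym (f∘g y)) ⟩
      B.col (f x)                                         ≡⟨ swapped x ⟩
      not (A.col x)                                       ≡⟨ sym (mirror-colour x) ⟩
      colour (complement a) (proj₁ (mirror x))            ≡⟨ cong (colour (complement a))
                                                                  (sym (toℕ-fromℕ< (mirror<N x))) ⟩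
      colour (complement a) (toℕ (mirrorOfPreimage y))    ≡⟨ cong (colour (complement a))
                                                                  (strictlyIncreasing⇒toℕ-id (sym N≡) mirrorOfPreimage
                                                                                             mirrorOfPreimage-increasing y) ⟩
      colour (complement a) (toℕ y)                       ≡⟨ cong (colour (complement a)) (toℕ-fromℕ< t<N) ⟩
      colour (complement a) t                             ∎
      where open ≡-Reasoning

  b≡a⊎b≡¬a : b ≡ a ⊎ b ≡ complement a
  b≡a⊎b≡¬a = Sum.map SameColours.b≡a SwappedColours.b≡¬a sameOrSwapped

isomorphic⇒equal-or-complement : ∀ a b → Iso (PA a) (PA b) → b ≡ a ⊎ b ≡ complement a
isomorphic⇒equal-or-complement a b iso = Isomorphic.b≡a⊎b≡¬a a b iso

theorem4p8 : (∀ (a : List Bool) → IsTwoChain (PA a))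
    × (∀ (n : ℕ) (R : FRel (suc (suc n))) → IsTwoChain R → Σ (List Bool) λ a → Iso R (PA a))
    × (∀ (a b : List Bool) → Iso (PA a) (PA b) → b ≡ a ⊎ b ≡ complement a)
theorem4p8 = PA-isTwoChain , twoChain⇒isomorphic , isomorphic⇒equal-or-complement
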